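{- Let $\mathbb F$ be a finite field, $R=\mathbb F[[\pi]]$ with maximal ideal $\mathfrak p=\pi R$. Let $G$ be a closed subgroup of $\mathrm{GL}_2(R)$ such that: (a) $\det(G)=R^\times$; (b) the image of $G$ modulo $\mathfrak p$ is $\mathrm{GL}_2(\mathbb F)$; (c) if $|\mathbb F|>2$, there is an element $I+\pi B\in G$ with $B\in M_2(R)$ such that $B$ modulo $\mathfrak p$ is a nonscalar matrix in $M_2(\mathbb F)$; (d) if $|\mathbb F|=2$, the image of $G$ modulo $\mathfrak p^2$ is $\mathrm{GL}_2(R/\mathfrak p^2)$; (e) if $|\mathbb F|=2$, $G\cap\mathrm{SL}_2(R)$ contains an element whose reduction modulo $\mathfrak p$ has order $2$ in $\mathrm{SL}_2(\mathbb F)$. Then $G=\mathrm{GL}_2(R)$. -}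

module Defs where

open import Level using (Level; _⊔_)
open import Data.Nat using (ℕ; zero; suc; _∸_; _<_)
open import Data.Fin using (Fin)
open import Data.Product using (Σ; ∃; _×_; _,_)
open import Relation.Nullary using (¬_)
open import Relation.Binary.PropositionalEquality using (_≡_)
import Relation.Binary.PropositionalEquality as ≡
open import Function.Bundles using (Inverse)
open import Algebra.Bundles using (CommutativeRing)

record FiniteField (c ℓ : Level) : Set (Level.suc (c ⊔ ℓ)) where
  field
    commRing : CommutativeRing c ℓ
  open CommutativeRing commRing public
  field
    0≉1      : ¬ (0# ≈ 1#)
    inverse  : ∀ x → ¬ (x ≈ 0#) → Σ Carrier (λ y → x * y ≈ 1#)
    size     : ℕ
    counting : Inverse setoid (≡.setoid (Fin size))

module PowerSeries {c ℓ : Level} (𝔽 : FiniteField c ℓ) where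
  open FiniteField 𝔽 renaming (Carrier to F)

  sumTo : ℕ → (ℕ → F) → F
  sumTo zero    f = 0#
  sumTo (suc n) f = sumTo n f + f n

  R : Set c
  R = ℕ → F

  _≈R_ : R → R → Set ℓ
  f ≈R g = ∀ n → f n ≈ g n

  0R 1R πR : R
  0R n = 0#
  1R zero = 1#
  1R (suc n) = 0#
  πR zero = 0#
  πR (suc zero) = 1#
  πR (suc (suc n)) = 0#

  infixl 6 _+R_ _-R_
  infixl 7 _*R_
  _+R_ _-R_ _*R_ : R → R → R
  (f +R g) n = f n + g n
  (f -R g) n = f n - g n
  (f *R g) n = sumTo (suc n) (λ i → f i * g (n ∸ i))

  _≡R_[mod𝔭^_] : R → R → ℕ → Set ℓ
  f ≡R g [mod𝔭^ k ] = ∀ n → n < k → f n ≈ g n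

  IsUnit : R → Set (c ⊔ ℓ)
  IsUnit f = Σ R (λ g → (f *R g) ≈R 1R)

  -- units of R/𝔭^k, with elements represented by lifts in R
  IsUnitMod𝔭^ : ℕ → R → Set (c ⊔ ℓ)
  IsUnitMod𝔭^ k f = Σ R (λ g → (f *R g) ≡R 1R [mod𝔭^ k ])

  record M₂ {a} (A : Set a) : Set a where
    constructor mat
    field
      e₁₁ e₁₂ e₂₁ e₂₂ : A
  open M₂ public

  Mat : Set c
  Mat = M₂ R

  _≈M_ : Mat → Mat → Set ℓ
  A ≈M B = (e₁₁ A ≈R e₁₁ B) × (e₁₂ A ≈R e₁₂ B) × (e₂₁ A ≈R e₂₁ B) × (e₂₂ A ≈R e₂₂ B)

  _≡M_[mod𝔭^_] : Mat → Mat → ℕ → Set ℓ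
  A ≡M B [mod𝔭^ k ] =
    (e₁₁ A ≡R e₁₁ B [mod𝔭^ k ]) × (e₁₂ A ≡R e₁₂ B [mod𝔭^ k ]) ×
    (e₂₁ A ≡R e₂₁ B [mod𝔭^ k ]) × (e₂₂ A ≡R e₂₂ B [mod𝔭^ k ])

  IM : Mat
  IM = mat 1R 0R 0R 1R

  infixl 7 _*M_
  infixl 6 _+M_
  _*M_ : Mat → Mat → Mat
  A *M B = mat (e₁₁ A *R e₁₁ B +R e₁₂ A *R e₂₁ B) (e₁₁ A *R e₁₂ B +R e₁₂ A *R e₂₂ B)
               (e₂₁ A *R e₁₁ B +R e₂₂ A *R e₂₁ B) (e₂₁ A *R e₁₂ B +R e₂₂ A *R e₂₂ B)

  _+M_ : Mat → Mat → Mat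
  A +M B = mat (e₁₁ A +R e₁₁ B) (e₁₂ A +R e₁₂ B) (e₂₁ A +R e₂₁ B) (e₂₂ A +R e₂₂ B)

  π·_ : Mat → Mat
  π· A = mat (πR *R e₁₁ A) (πR *R e₁₂ A) (πR *R e₂₁ A) (πR *R e₂₂ A)

  det : Mat → R
  det A = (e₁₁ A *R e₂₂ A) -R (e₁₂ A *R e₂₁ A)

  InGL₂ : Mat → Set (c ⊔ ℓ)
  InGL₂ A = IsUnit (det A)

  InSL₂ : Mat → Set ℓ
  InSL₂ A = det A ≈R 1R

  MatF : Set c
  MatF = M₂ F

  _≈F_ : MatF → MatF → Set ℓ
  A ≈F B = (e₁₁ A ≈ e₁₁ B) × (e₁₂ A ≈ e₁₂ B) × (e₂₁ A ≈ e₂₁ B) × (e₂₂ A ≈ e₂₂ B)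

  IF : MatF
  IF = mat 1# 0# 0# 1#

  infixl 7 _*F_
  _*F_ : MatF → MatF → MatF
  A *F B = mat (e₁₁ A * e₁₁ B + e₁₂ A * e₂₁ B) (e₁₁ A * e₁₂ B + e₁₂ A * e₂₂ B)
               (e₂₁ A * e₁₁ B + e₂₂ A * e₂₁ B) (e₂₁ A * e₁₂ B + e₂₂ A * e₂₂ B)

  detF : MatF → F
  detF A = (e₁₁ A * e₂₂ A) - (e₁₂ A * e₂₁ A)

  InGL₂F : MatF → Set ℓ
  InGL₂F A = ¬ (detF A ≈ 0#)

  reduce : Mat → MatF
  reduce A = mat (e₁₁ A 0) (e₁₂ A 0) (e₂₁ A 0) (e₂₂ A 0)

  IsScalarF : MatF → Set ℓ
  IsScalarF A = (e₁₂ A ≈ 0#) × (e₂₁ A ≈ 0#) × (e₁₁ A ≈ e₂₂ A)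

  record IsSubgroupGL₂ {p} (G : Mat → Set p) : Set (c ⊔ ℓ ⊔ p) where
    field
      resp    : ∀ {A B} → A ≈M B → G A → G B
      ⊆GL₂    : ∀ {A} → G A → InGL₂ A
      has-I   : G IM
      mul     : ∀ {A B} → G A → G B → G (A *M B)
      inv     : ∀ {A} → G A → Σ Mat (λ B → G B × ((A *M B) ≈M IM) × ((B *M A) ≈M IM))

  -- G is closed in the 𝔭-adic topology: a matrix approximated by
  -- elements of G modulo every 𝔭^k lies in G
  IsClosed : ∀ {p} → (Mat → Set p) → Set (c ⊔ ℓ ⊔ p)
  IsClosed G = ∀ A → (∀ k → Σ Mat (λ B → G B × (B ≡M A [mod𝔭^ k ]))) → G A

  -- (a) det(G) = R^×  (the inclusion det(G) ⊆ R^× holds as G ⊆ GL₂(R))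
  CondA : ∀ {p} → (Mat → Set p) → Set (c ⊔ ℓ ⊔ p)
  CondA G = ∀ u → IsUnit u → Σ Mat (λ A → G A × (det A ≈R u))

  CondB : ∀ {p} → (Mat → Set p) → Set (c ⊔ ℓ ⊔ p)
  CondB G = ∀ X → InGL₂F X → Σ Mat (λ A → G A × (reduce A ≈F X))

  CondC : ∀ {p} → (Mat → Set p) → Set (c ⊔ ℓ ⊔ p)
  CondC G = 2 < size →
    Σ Mat (λ B → G (IM +M (π· B)) × ¬ IsScalarF (reduce B))

  -- (d) if |𝔽| = 2: the image of G modulo 𝔭² is GL₂(R/𝔭²);
  -- elements of M₂(R/𝔭²) are represented by lifts A ∈ M₂(R), and such an
  -- A lies in GL₂(R/𝔭²) iff det A is a unit modulo 𝔭².
  CondD : ∀ {p} → (Mat → Set p) → Set (c ⊔ ℓ ⊔ p)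
  CondD G = size ≡ 2 →
    ∀ A → IsUnitMod𝔭^ 2 (det A) → Σ Mat (λ B → G B × (B ≡M A [mod𝔭^ 2 ]))

  CondE : ∀ {p} → (Mat → Set p) → Set (c ⊔ ℓ ⊔ p)
  CondE G = size ≡ 2 →
    Σ Mat (λ A → G A × InSL₂ A × ¬ (reduce A ≈F IF) × ((reduce A *F reduce A) ≈F IF))

{-# OPTIONS --safe #-}
module Submission where

open import Level using (Level; _⊔_)
open import Algebra.Bundles using (CommutativeRing; RawRing)
open import Data.Bool using (Bool; true; false; _∧_; _xor_)
open import Data.Bool.Properties using (xor-∧-commutativeRing)
open import Data.Empty using (⊥-elim)
open import Data.Fin using (Fin; #_)
open import Data.Maybe using (Maybe; just; nothing)
open import Data.Nat as ℕ using (ℕ; zero; suc; _∸_; _<_; _≤_; z≤n; s≤s)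
import Data.Nat.Properties as ℕ
open import Data.Product using (Σ; ∃; _×_; _,_; proj₁; proj₂)
open import Data.Sum as ⊎ using (_⊎_; inj₁; inj₂)
open import Data.Vec using (Vec; _∷_; [])
open import Function using (_∘_)
open import Function.Bundles using (Inverse; Injection)
open import Function.Properties.Inverse using (Inverse⇒Injection)
open import Relation.Binary using (Setoid)
import Relation.Binary.Reasoning.Setoid as ≈-Reasoning
open import Relation.Binary.PropositionalEquality as ≡ using (_≡_; _≢_)
open import Relation.Nullary using (¬_; Dec; yes; no; map′)
open import Relation.Nullary.Decidable using (isYes)
open import Defs

-- Let Γₙ be the matrices congruent to 1 modulo πⁿ. For n ≥ 1 the residue X of D ≡ 1 + πⁿX
-- (mod πⁿ⁺¹) is additive on Γₙ, and for a ≡ 1 + πᵏP, D ≡ 1 + πᵐY the commutator (Da)⁻¹aD is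
-- ≡ 1 + πᵏ⁺ᵐh⁻¹(PY − YP) with h = Da mod π; for k = 0 this is conjugation by GL₂(𝔽), the image
-- of G modulo π. Hypothesis (c), or (d) when |𝔽| = 2, yields elements of G ∩ SL₂(R) at level
-- one with every residue E₁₂(x); conjugation spreads these over all trace-zero residues, and
-- bracketing with an element ≡ diag(1 + π, 1) modulo π² carries them to every level. Hence an
-- approximation B ≡ A (mod πⁿ) with det B = det A can be improved modulo πⁿ⁺¹, because the
-- residue of B⁻¹A has trace zero. The first approximation comes from (a) and from G ∩ SL₂(R)
-- mapping onto SL₂(𝔽), which is generated by elementary matrices: commutators of lifts of
-- diagonal and unipotent matrices when |𝔽| > 2, conjugates of the involution of (e) when
-- |𝔽| = 2. As G is closed, it contains every A ∈ GL₂(R).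

-- Algebra.Solver.Ring normalises coefficients by computation, so it is run with integer
-- coefficients, mapped into S by the canonical homomorphism ℤ → S.
module IntegerCoefficientSolver {c ℓ} (S : CommutativeRing c ℓ) where
  open import Data.Integer as ℤ using (ℤ; +_; -[1+_]; _⊖_)
  import Data.Integer.Properties as ℤ
  open import Data.Sign as Sign using (Sign)
  open CommutativeRing S
  open import Algebra.Solver.Ring.AlmostCommutativeRing
  open import Algebra.Properties.Semiring.Mult.TCOptimised semiring renaming (_×_ to _·_)
  open import Algebra.Properties.Ring ring
  open import Algebra.Properties.CommutativeSemigroup +-commutativeSemigroup using (interchange)
  open ≈-Reasoning setoid

  ⟦_⟧ℤ : ℤ → Carrier
  ⟦ + n ⟧ℤ      = n · 1#
  ⟦ -[1+ n ] ⟧ℤ = - (suc n · 1#)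

  private
    signed : Sign → Carrier → Carrier
    signed Sign.+ x = x
    signed Sign.- x = - x

    signed-cong : ∀ s {x y} → x ≈ y → signed s x ≈ signed s y
    signed-cong Sign.+ x≈y = x≈y
    signed-cong Sign.- x≈y = -‿cong x≈y

    signed-* : ∀ s t x y → signed (s Sign.* t) (x * y) ≈ signed s x * signed t y
    signed-* Sign.+ Sign.+ x y = refl
    signed-* Sign.+ Sign.- x y = -‿distribʳ-* x y
    signed-* Sign.- Sign.+ x y = -‿distribˡ-* x y
    signed-* Sign.- Sign.- x y = begin
      x * y           ≈⟨ -‿involutive (x * y) ⟨
      - - (x * y)     ≈⟨ -‿cong (-‿distribʳ-* x y) ⟩
      - (x * - y)     ≈⟨ -‿distribˡ-* x (- y) ⟩
      - x * - y       ∎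

    ⟦◃⟧ : ∀ s n → ⟦ s ℤ.◃ n ⟧ℤ ≈ signed s (n · 1#)
    ⟦◃⟧ Sign.+ zero    = refl
    ⟦◃⟧ Sign.+ (suc n) = refl
    ⟦◃⟧ Sign.- zero    = sym -0#≈0#
    ⟦◃⟧ Sign.- (suc n) = refl

    ⟦sign◃∣∣⟧ : ∀ i → ⟦ i ⟧ℤ ≈ signed (ℤ.sign i) (ℤ.∣ i ∣ · 1#)
    ⟦sign◃∣∣⟧ (+ zero)   = refl
    ⟦sign◃∣∣⟧ (+ suc n)  = refl
    ⟦sign◃∣∣⟧ -[1+ n ]   = refl

    x+y-[x+z]≈y-z : ∀ x y z → (x + y) - (x + z) ≈ y - z
    x+y-[x+z]≈y-z x y z = begin
      (x + y) - (x + z)    ≈⟨ +-congˡ (-‿+-comm x z) ⟨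
      (x + y) + (- x - z)  ≈⟨ interchange x y (- x) (- z) ⟩
      (x - x) + (y - z)    ≈⟨ +-congʳ (-‿inverseʳ x) ⟩
      0# + (y - z)         ≈⟨ +-identityˡ _ ⟩
      y - z                ∎

    ⟦⊖⟧ : ∀ m n → ⟦ m ⊖ n ⟧ℤ ≈ m · 1# - n · 1#
    ⟦⊖⟧ zero    zero    = sym (-‿inverseʳ 0#)
    ⟦⊖⟧ zero    (suc n) = sym (+-identityˡ _)
    ⟦⊖⟧ (suc m) zero    = sym (trans (+-congˡ -0#≈0#) (+-identityʳ _))
    ⟦⊖⟧ (suc m) (suc n) = begin
      ⟦ suc m ⊖ suc n ⟧ℤ               ≡⟨ ≡.cong ⟦_⟧ℤ (ℤ.[1+m]⊖[1+n]≡m⊖n m n) ⟩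
      ⟦ m ⊖ n ⟧ℤ                       ≈⟨ ⟦⊖⟧ m n ⟩
      m · 1# - n · 1#                  ≈⟨ x+y-[x+z]≈y-z 1# _ _ ⟨
      (1# + m · 1#) - (1# + n · 1#)    ≈⟨ +-cong (1+× m 1#) (-‿cong (1+× n 1#)) ⟨
      suc m · 1# - suc n · 1#          ∎

    ⟦+⟧ : ∀ i j → ⟦ i ℤ.+ j ⟧ℤ ≈ ⟦ i ⟧ℤ + ⟦ j ⟧ℤ
    ⟦+⟧ (+ m)    (+ n)    = ×-homo-+ 1# m n
    ⟦+⟧ (+ m)    -[1+ n ] = ⟦⊖⟧ m (suc n)
    ⟦+⟧ -[1+ m ] (+ n)    = trans (⟦⊖⟧ n (suc m)) (+-comm _ _)
    ⟦+⟧ -[1+ m ] -[1+ n ] = begin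
      - (suc (suc (m ℕ.+ n)) · 1#)   ≡⟨ ≡.cong (λ k → - (suc k · 1#)) (ℕ.+-suc m n) ⟨
      - ((suc m ℕ.+ suc n) · 1#)     ≈⟨ -‿cong (×-homo-+ 1# (suc m) (suc n)) ⟩
      - (suc m · 1# + suc n · 1#)    ≈⟨ -‿+-comm _ _ ⟨
      - (suc m · 1#) - suc n · 1#    ∎

    ⟦*⟧ : ∀ i j → ⟦ i ℤ.* j ⟧ℤ ≈ ⟦ i ⟧ℤ * ⟦ j ⟧ℤ
    ⟦*⟧ i j = begin
      ⟦ i ℤ.* j ⟧ℤ                                   ≈⟨ ⟦◃⟧ (s Sign.* t) (ℤ.∣ i ∣ ℕ.* ℤ.∣ j ∣) ⟩
      signed (s Sign.* t) ((ℤ.∣ i ∣ ℕ.* ℤ.∣ j ∣) · 1#) ≈⟨ signed-cong (s Sign.* t) (×1-homo-* ℤ.∣ i ∣ ℤ.∣ j ∣) ⟩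
      signed (s Sign.* t) (∣i∣ * ∣j∣)                 ≈⟨ signed-* s t ∣i∣ ∣j∣ ⟩
      signed s ∣i∣ * signed t ∣j∣                     ≈⟨ *-cong (⟦sign◃∣∣⟧ i) (⟦sign◃∣∣⟧ j) ⟨
      ⟦ i ⟧ℤ * ⟦ j ⟧ℤ                                 ∎
      where
      s = ℤ.sign i
      t = ℤ.sign j
      ∣i∣ = ℤ.∣ i ∣ · 1#
      ∣j∣ = ℤ.∣ j ∣ · 1#

    ⟦-⟧ : ∀ i → ⟦ ℤ.- i ⟧ℤ ≈ - ⟦ i ⟧ℤ
    ⟦-⟧ (+ zero)  = sym -0#≈0#
    ⟦-⟧ (+ suc n) = refl
    ⟦-⟧ -[1+ n ]  = sym (-‿involutive _)

    ℤ-rawRing : RawRing _ _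
    ℤ-rawRing = record
      { Carrier = ℤ ; _≈_ = _≡_ ; _+_ = ℤ._+_ ; _*_ = ℤ._*_ ; -_ = ℤ.-_ ; 0# = + 0 ; 1# = + 1 }

    ⟦⟧-homomorphism : ℤ-rawRing -Raw-AlmostCommutative⟶ fromCommutativeRing S
    ⟦⟧-homomorphism = record
      { ⟦_⟧ = ⟦_⟧ℤ ; +-homo = ⟦+⟧ ; *-homo = ⟦*⟧ ; -‿homo = ⟦-⟧ ; 0-homo = refl ; 1-homo = refl }

    ⟦⟧-equal? : ∀ i j → Maybe (⟦ i ⟧ℤ ≈ ⟦ j ⟧ℤ)
    ⟦⟧-equal? i j with i ℤ.≟ j
    ... | yes ≡.refl = just refl
    ... | no _       = nothing

  open import Algebra.Solver.Ring ℤ-rawRing (fromCommutativeRing S) ⟦⟧-homomorphism ⟦⟧-equal? public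

  1ₚ 0ₚ : ∀ {n} → Polynomial n
  1ₚ = con (+ 1)
  0ₚ = con (+ 0)

module Matrices {c ℓ} (𝔽 : FiniteField c ℓ) where
  open PowerSeries 𝔽 using (M₂; mat; e₁₁; e₁₂; e₂₁; e₂₂)

  module _ {a b r : Level} {A : Set a} {B : Set b} where
    Pointwise : (A → B → Set r) → M₂ A → M₂ B → Set r
    Pointwise _∼_ X Y = (e₁₁ X ∼ e₁₁ Y) × (e₁₂ X ∼ e₁₂ Y) × (e₂₁ X ∼ e₂₁ Y) × (e₂₂ X ∼ e₂₂ Y)

  module _ {a r : Level} {A : Set a} where
    All : (A → Set r) → M₂ A → Set r
    All P X = P (e₁₁ X) × P (e₁₂ X) × P (e₂₁ X) × P (e₂₂ X)

  module _ {a b} {A : Set a} {B : Set b} where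
    map : (A → B) → M₂ A → M₂ B
    map f X = mat (f (e₁₁ X)) (f (e₁₂ X)) (f (e₂₁ X)) (f (e₂₂ X))

  module Over {s t} (S : CommutativeRing s t) where
    open CommutativeRing S
    open IntegerCoefficientSolver S

    Mat₂ : Set s
    Mat₂ = M₂ Carrier

    infix 4 _≈₂_
    _≈₂_ : Mat₂ → Mat₂ → Set t
    _≈₂_ = Pointwise _≈_

    setoid₂ : Setoid s t
    setoid₂ = record
      { Carrier = Mat₂
      ; _≈_ = _≈₂_
      ; isEquivalence = record
        { refl  = refl , refl , refl , refl
        ; sym   = λ (p , q , r , u) → sym p , sym q , sym r , sym u
        ; trans = λ (p , q , r , u) (p′ , q′ , r′ , u′) → trans p p′ , trans q q′ , trans r r′ , trans u u′ } }

    open Setoid setoid₂ public using () renaming (refl to ≈₂-refl; sym to ≈₂-sym; trans to ≈₂-trans)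

    infixl 6 _+₂_ _-₂_
    infixl 7 _*₂_
    0₂ 1₂ : Mat₂
    0₂ = mat 0# 0# 0# 0#
    1₂ = mat 1# 0# 0# 1#

    _+₂_ _-₂_ _*₂_ : Mat₂ → Mat₂ → Mat₂
    X +₂ Y = mat (e₁₁ X + e₁₁ Y) (e₁₂ X + e₁₂ Y) (e₂₁ X + e₂₁ Y) (e₂₂ X + e₂₂ Y)
    X -₂ Y = mat (e₁₁ X - e₁₁ Y) (e₁₂ X - e₁₂ Y) (e₂₁ X - e₂₁ Y) (e₂₂ X - e₂₂ Y)
    X *₂ Y = mat (e₁₁ X * e₁₁ Y + e₁₂ X * e₂₁ Y) (e₁₁ X * e₁₂ Y + e₁₂ X * e₂₂ Y)
                 (e₂₁ X * e₁₁ Y + e₂₂ X * e₂₁ Y) (e₂₁ X * e₁₂ Y + e₂₂ X * e₂₂ Y)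

    E₁₁ : Mat₂
    E₁₁ = mat 1# 0# 0# 0#

    E₁₂ E₂₁ upper lower : Carrier → Mat₂
    E₁₂ x = mat 0# x 0# 0#
    E₂₁ x = mat 0# 0# x 0#
    upper x = mat 1# x 0# 1#
    lower x = mat 1# 0# x 1#

    antidiag : Mat₂
    antidiag = mat 0# 1# 1# 0#

    infixr 7 _·₂_
    _·₂_ : Carrier → Mat₂ → Mat₂
    x ·₂ Y = mat (x * e₁₁ Y) (x * e₁₂ Y) (x * e₂₁ Y) (x * e₂₂ Y)

    det₂ tr₂ : Mat₂ → Carrier
    det₂ X = e₁₁ X * e₂₂ X - e₁₂ X * e₂₁ X
    tr₂ X = e₁₁ X + e₂₂ X

    +₂-cong : ∀ {X X′ Y Y′} → X ≈₂ X′ → Y ≈₂ Y′ → X +₂ Y ≈₂ X′ +₂ Y′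
    +₂-cong (p , q , r , u) (p′ , q′ , r′ , u′) = +-cong p p′ , +-cong q q′ , +-cong r r′ , +-cong u u′

    -₂-cong : ∀ {X X′ Y Y′} → X ≈₂ X′ → Y ≈₂ Y′ → X -₂ Y ≈₂ X′ -₂ Y′
    -₂-cong (p , q , r , u) (p′ , q′ , r′ , u′) =
      +-cong p (-‿cong p′) , +-cong q (-‿cong q′) , +-cong r (-‿cong r′) , +-cong u (-‿cong u′)

    *₂-cong : ∀ {X X′ Y Y′} → X ≈₂ X′ → Y ≈₂ Y′ → X *₂ Y ≈₂ X′ *₂ Y′
    *₂-cong (p , q , r , u) (p′ , q′ , r′ , u′) =
      +-cong (*-cong p p′) (*-cong q r′) , +-cong (*-cong p q′) (*-cong q u′) ,
      +-cong (*-cong r p′) (*-cong u r′) , +-cong (*-cong r q′) (*-cong u u′)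

    det₂-cong : ∀ {X Y} → X ≈₂ Y → det₂ X ≈ det₂ Y
    det₂-cong (p , q , r , u) = +-cong (*-cong p u) (-‿cong (*-cong q r))

    -- Counterparts of the matrix operations on matrices of polynomials (prefixed by :), so that
    -- matrix identities can be checked entrywise by the solver.
    module _ {n : ℕ} where
      Matₚ : Set
      Matₚ = M₂ (Polynomial n)

      infixl 6 _:+₂_ _:-₂_
      infixl 7 _:*₂_
      _:+₂_ _:-₂_ _:*₂_ : Matₚ → Matₚ → Matₚ
      X :+₂ Y = mat (e₁₁ X :+ e₁₁ Y) (e₁₂ X :+ e₁₂ Y) (e₂₁ X :+ e₂₁ Y) (e₂₂ X :+ e₂₂ Y)
      X :-₂ Y = mat (e₁₁ X :- e₁₁ Y) (e₁₂ X :- e₁₂ Y) (e₂₁ X :- e₂₁ Y) (e₂₂ X :- e₂₂ Y)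
      X :*₂ Y = mat (e₁₁ X :* e₁₁ Y :+ e₁₂ X :* e₂₁ Y) (e₁₁ X :* e₁₂ Y :+ e₁₂ X :* e₂₂ Y)
                    (e₂₁ X :* e₁₁ Y :+ e₂₂ X :* e₂₁ Y) (e₂₁ X :* e₁₂ Y :+ e₂₂ X :* e₂₂ Y)

      :1₂ : Matₚ
      :1₂ = mat 1ₚ 0ₚ 0ₚ 1ₚ

      ⟦_⟧₂ : Matₚ → Vec Carrier n → Mat₂
      ⟦ X ⟧₂ ρ = map (λ p → ⟦ p ⟧ ρ) X

      prove₂ : ∀ ρ (X Y : Matₚ) → Pointwise (λ p q → ⟦ p ⟧↓ ρ ≈ ⟦ q ⟧↓ ρ) X Y → ⟦ X ⟧₂ ρ ≈₂ ⟦ Y ⟧₂ ρ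
      prove₂ ρ X Y (p , q , r , u) =
        prove ρ (e₁₁ X) (e₁₁ Y) p , prove ρ (e₁₂ X) (e₁₂ Y) q , prove ρ (e₂₁ X) (e₂₁ Y) r , prove ρ (e₂₂ X) (e₂₂ Y) u

      infixr 7 _:·₂_
      _:·₂_ : Polynomial n → Matₚ → Matₚ
      x :·₂ Y = mat (x :* e₁₁ Y) (x :* e₁₂ Y) (x :* e₂₁ Y) (x :* e₂₂ Y)

      :E₁₁ : Matₚ
      :E₁₁ = mat 1ₚ 0ₚ 0ₚ 0ₚ

      :E₁₂ :E₂₁ :upper :lower : Polynomial n → Matₚ
      :E₁₂ x = mat 0ₚ x 0ₚ 0ₚ
      :E₂₁ x = mat 0ₚ 0ₚ x 0ₚ
      :upper x = mat 1ₚ x 0ₚ 1ₚ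
      :lower x = mat 1ₚ 0ₚ x 1ₚ

      :antidiag : Matₚ
      :antidiag = mat 0ₚ 1ₚ 1ₚ 0ₚ

      :det₂ :tr₂ : Matₚ → Polynomial n
      :det₂ X = e₁₁ X :* e₂₂ X :- e₁₂ X :* e₂₁ X
      :tr₂ X = e₁₁ X :+ e₂₂ X

    private
      module Vars₁ where
        X : Matₚ {4}
        X = mat (var (# 0)) (var (# 1)) (var (# 2)) (var (# 3))
      module Vars₂ where
        X Y : Matₚ {8}
        X = mat (var (# 0)) (var (# 1)) (var (# 2)) (var (# 3))
        Y = mat (var (# 4)) (var (# 5)) (var (# 6)) (var (# 7))
      module Vars₃ where
        X Y Z : Matₚ {12}
        X = mat (var (# 0)) (var (# 1)) (var (# 2)) (var (# 3))
        Y = mat (var (# 4)) (var (# 5)) (var (# 6)) (var (# 7))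
        Z = mat (var (# 8)) (var (# 9)) (var (# 10)) (var (# 11))

    *₂-assoc : ∀ X Y Z → (X *₂ Y) *₂ Z ≈₂ X *₂ (Y *₂ Z)
    *₂-assoc (mat a b c d) (mat e f g h) (mat i j k l) =
      prove₂ (a ∷ b ∷ c ∷ d ∷ e ∷ f ∷ g ∷ h ∷ i ∷ j ∷ k ∷ l ∷ []) ((X :*₂ Y) :*₂ Z) (X :*₂ (Y :*₂ Z))
        (refl , refl , refl , refl)
      where open Vars₃

    *₂-identityˡ : ∀ X → 1₂ *₂ X ≈₂ X
    *₂-identityˡ (mat a b c d) = prove₂ (a ∷ b ∷ c ∷ d ∷ []) (:1₂ :*₂ X) X (refl , refl , refl , refl)
      where open Vars₁

    *₂-identityʳ : ∀ X → X *₂ 1₂ ≈₂ X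
    *₂-identityʳ (mat a b c d) = prove₂ (a ∷ b ∷ c ∷ d ∷ []) (X :*₂ :1₂) X (refl , refl , refl , refl)
      where open Vars₁

    *₂-distribˡ-₂ : ∀ X Y Z → X *₂ Y -₂ X *₂ Z ≈₂ X *₂ (Y -₂ Z)
    *₂-distribˡ-₂ (mat a b c d) (mat e f g h) (mat i j k l) =
      prove₂ (a ∷ b ∷ c ∷ d ∷ e ∷ f ∷ g ∷ h ∷ i ∷ j ∷ k ∷ l ∷ []) (X :*₂ Y :-₂ X :*₂ Z) (X :*₂ (Y :-₂ Z))
        (refl , refl , refl , refl)
      where open Vars₃

    det₂-* : ∀ X Y → det₂ (X *₂ Y) ≈ det₂ X * det₂ Y
    det₂-* (mat a b c d) (mat e f g h) =
      prove (a ∷ b ∷ c ∷ d ∷ e ∷ f ∷ g ∷ h ∷ []) (:det₂ (X :*₂ Y)) (:det₂ X :* :det₂ Y) refl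
      where open Vars₂

    +₂-identityʳ : ∀ X → X +₂ 0₂ ≈₂ X
    +₂-identityʳ X = +-identityʳ _ , +-identityʳ _ , +-identityʳ _ , +-identityʳ _

    -₂-identityʳ : ∀ X → X -₂ 0₂ ≈₂ X
    -₂-identityʳ X = x-0≈x , x-0≈x , x-0≈x , x-0≈x
      where
      open import Algebra.Properties.Ring ring using (-0#≈0#)
      x-0≈x : ∀ {x} → x - 0# ≈ x
      x-0≈x = trans (+-congˡ -0#≈0#) (+-identityʳ _)

    +₂-vanishing : ∀ X {u P} → u ≈ 0# → X +₂ u ·₂ P ≈₂ X
    +₂-vanishing X {u} u≈0 = vanish , vanish , vanish , vanish
      where
      vanish : ∀ {x p} → x + u * p ≈ x
      vanish = trans (+-congˡ (trans (*-congʳ u≈0) (zeroˡ _))) (+-identityʳ _)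

    det₂-*-comm : ∀ X Y → det₂ (X *₂ Y) ≈ det₂ (Y *₂ X)
    det₂-*-comm X Y = trans (det₂-* X Y) (trans (*-comm _ _) (sym (det₂-* Y X)))

    det₂-1 : det₂ 1₂ ≈ 1#
    det₂-1 = prove [] (:det₂ :1₂) 1ₚ refl

    -₂-via-1 : ∀ X Y → X -₂ Y ≈₂ (X -₂ 1₂) -₂ (Y -₂ 1₂)
    -₂-via-1 (mat a b c d) (mat e f g h) =
      prove₂ (a ∷ b ∷ c ∷ d ∷ e ∷ f ∷ g ∷ h ∷ []) (X :-₂ Y) ((X :-₂ :1₂) :-₂ (Y :-₂ :1₂)) (refl , refl , refl , refl)
      where open Vars₂

    -1-rebase : ∀ X Y → X -₂ 1₂ ≈₂ (Y -₂ 1₂) -₂ (Y -₂ X)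
    -1-rebase (mat a b c d) (mat e f g h) =
      prove₂ (a ∷ b ∷ c ∷ d ∷ e ∷ f ∷ g ∷ h ∷ []) (X :-₂ :1₂) ((Y :-₂ :1₂) :-₂ (Y :-₂ X)) (refl , refl , refl , refl)
      where open Vars₂

    *₂-1-expand : ∀ X Y → X *₂ Y -₂ 1₂ ≈₂ ((X -₂ 1₂) +₂ (Y -₂ 1₂)) +₂ (X -₂ 1₂) *₂ (Y -₂ 1₂)
    *₂-1-expand (mat a b c d) (mat e f g h) =
      prove₂ (a ∷ b ∷ c ∷ d ∷ e ∷ f ∷ g ∷ h ∷ []) (X :*₂ Y :-₂ :1₂)
        ((X :-₂ :1₂ :+₂ (Y :-₂ :1₂)) :+₂ (X :-₂ :1₂) :*₂ (Y :-₂ :1₂)) (refl , refl , refl , refl)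
      where open Vars₂

    *₂-comm-expand : ∀ X Y → X *₂ Y -₂ Y *₂ X ≈₂ (X -₂ 1₂) *₂ (Y -₂ 1₂) -₂ (Y -₂ 1₂) *₂ (X -₂ 1₂)
    *₂-comm-expand (mat a b c d) (mat e f g h) =
      prove₂ (a ∷ b ∷ c ∷ d ∷ e ∷ f ∷ g ∷ h ∷ []) (X :*₂ Y :-₂ Y :*₂ X)
        ((X :-₂ :1₂) :*₂ (Y :-₂ :1₂) :-₂ (Y :-₂ :1₂) :*₂ (X :-₂ :1₂)) (refl , refl , refl , refl)
      where open Vars₂

    det₂-1-expand : ∀ X → det₂ X ≈ (1# + tr₂ (X -₂ 1₂)) + det₂ (X -₂ 1₂)
    det₂-1-expand (mat a b c d) =
      prove (a ∷ b ∷ c ∷ d ∷ []) (:det₂ X) ((1ₚ :+ :tr₂ (X :-₂ :1₂)) :+ :det₂ (X :-₂ :1₂)) refl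
      where open Vars₁

    inverse-unique : ∀ {X Y Z} → Y *₂ X ≈₂ 1₂ → X *₂ Z ≈₂ 1₂ → Y ≈₂ Z
    inverse-unique {X} {Y} {Z} YX≈1 XZ≈1 = begin
      Y              ≈⟨ *₂-identityʳ Y ⟨
      Y *₂ 1₂        ≈⟨ *₂-cong ≈₂-refl XZ≈1 ⟨
      Y *₂ (X *₂ Z)  ≈⟨ *₂-assoc Y X Z ⟨
      (Y *₂ X) *₂ Z  ≈⟨ *₂-cong YX≈1 ≈₂-refl ⟩
      1₂ *₂ Z        ≈⟨ *₂-identityˡ Z ⟩
      Z              ∎
      where open ≈-Reasoning setoid₂

    det₂-inverse : ∀ {X Y} → Y *₂ X ≈₂ 1₂ → det₂ Y * det₂ X ≈ 1#
    det₂-inverse {X} {Y} YX≈1 = trans (sym (det₂-* Y X)) (trans (det₂-cong YX≈1) det₂-1)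

  module _ {s₁ t₁ s₂ t₂} (S : CommutativeRing s₁ t₁) (T : CommutativeRing s₂ t₂) where
    private
      module S = CommutativeRing S
      module T = CommutativeRing T
      module S₂ = Over S
      module T₂ = Over T

    module _ (f : S.Carrier → T.Carrier)
      (f-+ : ∀ x y → f (x S.+ y) T.≈ f x T.+ f y) (f-* : ∀ x y → f (x S.* y) T.≈ f x T.* f y) where

      private
        f-ab+cd : ∀ a b c d → f (a S.* b S.+ c S.* d) T.≈ f a T.* f b T.+ f c T.* f d
        f-ab+cd a b c d = T.trans (f-+ _ _) (T.+-cong (f-* a b) (f-* c d))

      map-*₂ : ∀ X Y → map f (X S₂.*₂ Y) T₂.≈₂ map f X T₂.*₂ map f Y
      map-*₂ (mat a b c d) (mat e g h k) = f-ab+cd a e b h , f-ab+cd a g b k , f-ab+cd c e d h , f-ab+cd c g d k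

      map-det₂ : (∀ x → f (S.- x) T.≈ T.- f x) → ∀ X → f (S₂.det₂ X) T.≈ T₂.det₂ (map f X)
      map-det₂ f-- (mat a b c d) = T.trans (f-+ _ _) (T.+-cong (f-* a d) (T.trans (f-- _) (T.-‿cong (f-* b c))))

module PowerSeriesRing {c ℓ} (𝔽 : FiniteField c ℓ) where
  open FiniteField 𝔽 renaming (Carrier to F)
  open PowerSeries 𝔽
  open import Algebra.Properties.CommutativeSemigroup +-commutativeSemigroup using (interchange)
  open ≈-Reasoning setoid

  sumTo-cong : ∀ n {f g} → (∀ i → i < n → f i ≈ g i) → sumTo n f ≈ sumTo n g
  sumTo-cong zero    f≈g = refl
  sumTo-cong (suc n) f≈g = +-cong (sumTo-cong n (λ i i<n → f≈g i (ℕ.m<n⇒m<1+n i<n))) (f≈g n ℕ.≤-refl)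

  sumTo-zero : ∀ n {f} → (∀ i → i < n → f i ≈ 0#) → sumTo n f ≈ 0#
  sumTo-zero zero    f≈0 = refl
  sumTo-zero (suc n) f≈0 =
    trans (+-cong (sumTo-zero n (λ i i<n → f≈0 i (ℕ.m<n⇒m<1+n i<n))) (f≈0 n ℕ.≤-refl)) (+-identityˡ 0#)

  sumTo-single : ∀ n {f} j → j < n → (∀ i → i < n → i ≢ j → f i ≈ 0#) → sumTo n f ≈ f j
  sumTo-single (suc n) j j<1+n f≈0 with j ℕ.≟ n
  ... | yes ≡.refl = trans (+-congʳ (sumTo-zero n (λ i i<n → f≈0 i (ℕ.m<n⇒m<1+n i<n) (ℕ.<⇒≢ i<n)))) (+-identityˡ _)
  ... | no j≢n     = trans (+-cong (sumTo-single n j (ℕ.≤∧≢⇒< (ℕ.≤-pred j<1+n) j≢n) (λ i i<n → f≈0 i (ℕ.m<n⇒m<1+n i<n)))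
                                   (f≈0 n ℕ.≤-refl (j≢n ∘ ≡.sym)))
                           (+-identityʳ _)

  sumTo-+ : ∀ n f g → sumTo n (λ i → f i + g i) ≈ sumTo n f + sumTo n g
  sumTo-+ zero    f g = sym (+-identityˡ 0#)
  sumTo-+ (suc n) f g = trans (+-congʳ (sumTo-+ n f g)) (interchange _ _ _ _)

  sumTo-*ˡ : ∀ n a f → sumTo n (λ i → a * f i) ≈ a * sumTo n f
  sumTo-*ˡ zero    a f = sym (zeroʳ a)
  sumTo-*ˡ (suc n) a f = trans (+-congʳ (sumTo-*ˡ n a f)) (sym (distribˡ a _ _))

  sumTo-*ʳ : ∀ n a f → sumTo n (λ i → f i * a) ≈ sumTo n f * a
  sumTo-*ʳ zero    a f = sym (zeroˡ a)
  sumTo-*ʳ (suc n) a f = trans (+-congʳ (sumTo-*ʳ n a f)) (sym (distribʳ a _ _))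

  sumTo-suc : ∀ n f → sumTo (suc n) f ≈ f 0 + sumTo n (λ i → f (suc i))
  sumTo-suc zero    f = trans (+-identityˡ _) (sym (+-identityʳ _))
  sumTo-suc (suc n) f = trans (+-congʳ (sumTo-suc n f)) (+-assoc _ _ _)

  sumTo-reverse : ∀ n f → sumTo (suc n) f ≈ sumTo (suc n) (λ i → f (n ∸ i))
  sumTo-reverse zero    f = refl
  sumTo-reverse (suc n) f = begin
    sumTo (suc n) f + f (suc n)                      ≈⟨ +-congʳ (sumTo-reverse n f) ⟩
    sumTo (suc n) (λ i → f (n ∸ i)) + f (suc n)      ≈⟨ +-comm _ _ ⟩
    f (suc n) + sumTo (suc n) (λ i → f (n ∸ i))      ≈⟨ sumTo-suc (suc n) (λ i → f (suc n ∸ i)) ⟨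
    sumTo (suc (suc n)) (λ i → f (suc n ∸ i))        ∎

  sumTo-triangle : ∀ n (φ : ℕ → ℕ → F) →
    sumTo (suc n) (λ i → sumTo (suc i) (λ j → φ j (i ∸ j))) ≈
    sumTo (suc n) (λ j → sumTo (suc (n ∸ j)) (φ j))
  sumTo-triangle zero    φ = refl
  sumTo-triangle (suc n) φ = begin
    sumTo (suc n) (λ i → sumTo (suc i) (λ j → φ j (i ∸ j))) + sumTo (suc (suc n)) (λ j → φ j (suc n ∸ j))
      ≈⟨ +-congʳ (sumTo-triangle n φ) ⟩
    sumTo (suc n) (λ j → sumTo (suc (n ∸ j)) (φ j)) + (sumTo (suc n) (λ j → φ j (suc n ∸ j)) + φ (suc n) (suc n ∸ suc n))
      ≈⟨ +-assoc _ _ _ ⟨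
    (sumTo (suc n) (λ j → sumTo (suc (n ∸ j)) (φ j)) + sumTo (suc n) (λ j → φ j (suc n ∸ j))) + φ (suc n) (n ∸ n)
      ≈⟨ +-congʳ (sumTo-+ (suc n) _ _) ⟨
    sumTo (suc n) (λ j → sumTo (suc (n ∸ j)) (φ j) + φ j (suc n ∸ j)) + φ (suc n) (n ∸ n)
      ≈⟨ +-cong (sumTo-cong (suc n) extend) last ⟩
    sumTo (suc n) (λ j → sumTo (suc (suc n ∸ j)) (φ j)) + sumTo (suc (n ∸ n)) (φ (suc n)) ∎
    where
    last : φ (suc n) (n ∸ n) ≈ sumTo (suc (n ∸ n)) (φ (suc n))
    last rewrite ℕ.n∸n≡0 n = sym (+-identityˡ _)
    extend : ∀ j → j < suc n → sumTo (suc (n ∸ j)) (φ j) + φ j (suc n ∸ j) ≈ sumTo (suc (suc n ∸ j)) (φ j)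
    extend j j<1+n rewrite ℕ.+-∸-assoc 1 (ℕ.≤-pred j<1+n) = refl

  *R-cong : ∀ {f f′ g g′} → f ≈R f′ → g ≈R g′ → (f *R g) ≈R (f′ *R g′)
  *R-cong f≈f′ g≈g′ n = sumTo-cong (suc n) (λ i _ → *-cong (f≈f′ i) (g≈g′ (n ∸ i)))

  *R-comm : ∀ f g → (f *R g) ≈R (g *R f)
  *R-comm f g n = begin
    sumTo (suc n) (λ i → f i * g (n ∸ i))               ≈⟨ sumTo-reverse n _ ⟩
    sumTo (suc n) (λ i → f (n ∸ i) * g (n ∸ (n ∸ i)))   ≈⟨ sumTo-cong (suc n) swap ⟩
    sumTo (suc n) (λ i → g i * f (n ∸ i))               ∎
    where
    swap : ∀ i → i < suc n → f (n ∸ i) * g (n ∸ (n ∸ i)) ≈ g i * f (n ∸ i)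
    swap i i<1+n rewrite ℕ.m∸[m∸n]≡n (ℕ.≤-pred i<1+n) = *-comm _ _

  *R-identityˡ : ∀ f → (1R *R f) ≈R f
  *R-identityˡ f n = trans (sumTo-single (suc n) 0 (s≤s z≤n) vanish) (*-identityˡ _)
    where
    vanish : ∀ i → i < suc n → i ≢ 0 → 1R i * f (n ∸ i) ≈ 0#
    vanish zero    _ i≢0 = ⊥-elim (i≢0 ≡.refl)
    vanish (suc i) _ _   = zeroˡ _

  *R-distribˡ : ∀ f g h → (f *R (g +R h)) ≈R ((f *R g) +R (f *R h))
  *R-distribˡ f g h n = trans (sumTo-cong (suc n) (λ i _ → distribˡ (f i) _ _)) (sumTo-+ (suc n) _ _)

  *R-assoc : ∀ f g h → ((f *R g) *R h) ≈R (f *R (g *R h))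
  *R-assoc f g h n = begin
    sumTo (suc n) (λ i → sumTo (suc i) (λ j → f j * g (i ∸ j)) * h (n ∸ i))
      ≈⟨ sumTo-cong (suc n) (λ i _ → sym (sumTo-*ʳ (suc i) _ _)) ⟩
    sumTo (suc n) (λ i → sumTo (suc i) (λ j → (f j * g (i ∸ j)) * h (n ∸ i)))
      ≈⟨ sumTo-cong (suc n) (λ i _ → sumTo-cong (suc i) reassociate) ⟩
    sumTo (suc n) (λ i → sumTo (suc i) (λ j → φ j (i ∸ j)))
      ≈⟨ sumTo-triangle n φ ⟩
    sumTo (suc n) (λ j → sumTo (suc (n ∸ j)) (φ j))
      ≈⟨ sumTo-cong (suc n) (λ j _ → trans (sumTo-cong (suc (n ∸ j)) (regroup j)) (sumTo-*ˡ (suc (n ∸ j)) _ _)) ⟩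
    sumTo (suc n) (λ j → f j * sumTo (suc (n ∸ j)) (λ k → g k * h ((n ∸ j) ∸ k))) ∎
    where
    φ : ℕ → ℕ → F
    φ j k = f j * (g k * h (n ∸ (j ℕ.+ k)))
    reassociate : ∀ {i} j → j < suc i → (f j * g (i ∸ j)) * h (n ∸ i) ≈ φ j (i ∸ j)
    reassociate {i} j j<1+i rewrite ℕ.m+[n∸m]≡n (ℕ.≤-pred j<1+i) = *-assoc _ _ _
    regroup : ∀ j k → k < suc (n ∸ j) → φ j k ≈ f j * (g k * h ((n ∸ j) ∸ k))
    regroup j k _ rewrite ℕ.∸-+-assoc n j k = refl

  R-commutativeRing : CommutativeRing c ℓ
  R-commutativeRing = record
    { isCommutativeRing = record
      { isRing = record
        { +-isAbelianGroup = record
          { isGroup = record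
            { isMonoid = record
              { isSemigroup = record
                { isMagma = record
                  { isEquivalence = record
                    { refl = λ n → refl ; sym = λ f≈g n → sym (f≈g n) ; trans = λ f≈g g≈h n → trans (f≈g n) (g≈h n) }
                  ; ∙-cong = λ f≈f′ g≈g′ n → +-cong (f≈f′ n) (g≈g′ n) }
                ; assoc = λ f g h n → +-assoc (f n) (g n) (h n) }
              ; identity = (λ f n → +-identityˡ (f n)) , (λ f n → +-identityʳ (f n)) }
            ; inverse = (λ f n → -‿inverseˡ (f n)) , (λ f n → -‿inverseʳ (f n))
            ; ⁻¹-cong = λ f≈g n → -‿cong (f≈g n) }
          ; comm = λ f g n → +-comm (f n) (g n) }
        ; *-cong = *R-cong
        ; *-assoc = *R-assoc
        ; *-identity = *R-identityˡ , λ f n → trans (*R-comm f 1R n) (*R-identityˡ f n)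
        ; distrib = *R-distribˡ , λ f g h n →
            trans (*R-comm (g +R h) f n) (trans (*R-distribˡ f g h n) (+-cong (*R-comm f g n) (*R-comm f h n))) }
      ; *-comm = *R-comm } }

  private module 𝓡 = CommutativeRing R-commutativeRing

  πR*-zero : ∀ f → (πR *R f) 0 ≈ 0#
  πR*-zero f = trans (+-identityˡ _) (zeroˡ _)

  πR*-suc : ∀ m f → (πR *R f) (suc m) ≈ f m
  πR*-suc m f = trans (sumTo-single (suc (suc m)) 1 (s≤s (s≤s z≤n)) vanish) (*-identityˡ _)
    where
    vanish : ∀ i → i < suc (suc m) → i ≢ 1 → πR i * f (suc m ∸ i) ≈ 0#
    vanish zero          _ _   = zeroˡ _
    vanish (suc zero)    _ i≢1 = ⊥-elim (i≢1 ≡.refl)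
    vanish (suc (suc i)) _ _   = zeroˡ _

  1+π-isUnit : IsUnit (1R +R πR)
  1+π-isUnit = alternating , λ n →
    trans (𝓡.distribʳ alternating 1R πR n) (trans (+-congʳ (*R-identityˡ alternating n)) (cancel n))
    where
    alternating : R
    alternating zero    = 1#
    alternating (suc n) = - alternating n
    cancel : ∀ n → alternating n + (πR *R alternating) n ≈ 1R n
    cancel zero    = trans (+-congˡ (πR*-zero alternating)) (+-identityʳ 1#)
    cancel (suc m) = trans (+-congˡ (πR*-suc m alternating)) (-‿inverseˡ (alternating m))

module Valuation {c ℓ} (𝔽 : FiniteField c ℓ) where
  open import Data.Nat using (_+_)
  open FiniteField 𝔽 renaming (Carrier to F) hiding (_+_)
  open PowerSeries 𝔽
  open PowerSeriesRing 𝔽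

  infix 4 _∈𝔭^_
  _∈𝔭^_ : R → ℕ → Set ℓ
  f ∈𝔭^ n = ∀ m → m < n → f m ≈ 0#

  private
    low-or-high : ∀ a b {i m} → i ≤ m → m < a + b → i < a ⊎ m ∸ i < b
    low-or-high a b {i} {m} i≤m m<a+b with i ℕ.<? a
    ... | yes i<a = inj₁ i<a
    ... | no  i≮a = inj₂ (≡.subst (m ∸ i <_) (ℕ.m+n∸m≡n i b)
                            (ℕ.∸-monoˡ-< (ℕ.<-≤-trans m<a+b (ℕ.+-monoˡ-≤ b (ℕ.≮⇒≥ i≮a))) i≤m))

    term-vanishes : ∀ {a b f g} i m → f ∈𝔭^ a → g ∈𝔭^ b → i < a ⊎ m ∸ i < b → f i * g (m ∸ i) ≈ 0#
    term-vanishes i m f∈ g∈ (inj₁ i<a)   = trans (*-congʳ (f∈ i i<a)) (zeroˡ _)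
    term-vanishes i m f∈ g∈ (inj₂ m∸i<b) = trans (*-congˡ (g∈ (m ∸ i) m∸i<b)) (zeroʳ _)

  *R-∈𝔭^ : ∀ a b {f g} → f ∈𝔭^ a → g ∈𝔭^ b → (f *R g) ∈𝔭^ (a + b)
  *R-∈𝔭^ a b f∈ g∈ m m<a+b =
    sumTo-zero (suc m) (λ i i≤m → term-vanishes i m f∈ g∈ (low-or-high a b (ℕ.≤-pred i≤m) m<a+b))

  *R-leading : ∀ a b {f g} → f ∈𝔭^ a → g ∈𝔭^ b → (f *R g) (a + b) ≈ f a * g b
  *R-leading a b {f} {g} f∈ g∈ = trans
    (sumTo-single (suc (a + b)) a (s≤s (ℕ.m≤m+n a b)) (λ i i≤a+b i≢a → term-vanishes i (a + b) f∈ g∈ (other i i≤a+b i≢a)))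
    (*-congˡ (reflexive (≡.cong g (ℕ.m+n∸m≡n a b))))
    where
    other : ∀ i → i < suc (a + b) → i ≢ a → i < a ⊎ (a + b) ∸ i < b
    other i i≤a+b i≢a with i ℕ.<? a
    ... | yes i<a = inj₁ i<a
    ... | no  i≮a = inj₂ (≡.subst ((a + b) ∸ i <_) (ℕ.m+n∸m≡n i b)
                           (ℕ.∸-monoˡ-< (ℕ.+-monoˡ-< b (ℕ.≤∧≢⇒< (ℕ.≮⇒≥ i≮a) (i≢a ∘ ≡.sym))) (ℕ.≤-pred i≤a+b)))

  ∈𝔭^1 : ∀ {f} → f 0 ≈ 0# → f ∈𝔭^ 1
  ∈𝔭^1 f0≈0 zero    _         = f0≈0
  ∈𝔭^1 f0≈0 (suc m) (s≤s ())

  ∈𝔭^-resp : ∀ {n f g} → f ≈R g → f ∈𝔭^ n → g ∈𝔭^ n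
  ∈𝔭^-resp f≈g f∈ m m<n = trans (sym (f≈g m)) (f∈ m m<n)

  ∈𝔭^-≤ : ∀ {m n f} → m ≤ n → f ∈𝔭^ n → f ∈𝔭^ m
  ∈𝔭^-≤ m≤n f∈ k k<m = f∈ k (ℕ.<-≤-trans k<m m≤n)

  +R-∈𝔭^ : ∀ {n f g} → f ∈𝔭^ n → g ∈𝔭^ n → (f +R g) ∈𝔭^ n
  +R-∈𝔭^ f∈ g∈ m m<n = trans (+-cong (f∈ m m<n) (g∈ m m<n)) (+-identityˡ 0#)

  -R-∈𝔭^ : ∀ {n f g} → f ∈𝔭^ n → g ∈𝔭^ n → (f -R g) ∈𝔭^ n
  -R-∈𝔭^ f∈ g∈ m m<n = trans (+-cong (f∈ m m<n) (-‿cong (g∈ m m<n))) (-‿inverseʳ 0#)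

  -R-∈𝔭^-suc : ∀ {n f g} → f ∈𝔭^ n → g ∈𝔭^ n → f n ≈ g n → (f -R g) ∈𝔭^ suc n
  -R-∈𝔭^-suc {n} f∈ g∈ fn≈gn m m<1+n with m ℕ.<? n
  ... | yes m<n = -R-∈𝔭^ f∈ g∈ m m<n
  ... | no  m≮n with ℕ.≤-antisym (ℕ.≤-pred m<1+n) (ℕ.≮⇒≥ m≮n)
  ... | ≡.refl = trans (+-congʳ fn≈gn) (-‿inverseʳ _)

module MatrixValuation {c ℓ} (𝔽 : FiniteField c ℓ) where
  open import Data.Nat using (_+_)
  open FiniteField 𝔽 renaming (Carrier to F) hiding (_+_)
  open PowerSeries 𝔽
  open PowerSeriesRing 𝔽
  open Valuation 𝔽
  open Matrices 𝔽
  module M = Over R-commutativeRing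
  module MF = Over commRing
  open M public using () renaming (_-₂_ to _-M_)
  open MF public using () renaming (_-₂_ to _-F_; _+₂_ to _+F_)

  infix 4 _∈M𝔭^_
  _∈M𝔭^_ : Mat → ℕ → Set ℓ
  A ∈M𝔭^ n = All (_∈𝔭^ n) A

  coeff : ℕ → Mat → MatF
  coeff n = map (λ f → f n)

  ∈M𝔭^-zero : ∀ A → A ∈M𝔭^ 0
  ∈M𝔭^-zero A = (λ _ ()) , (λ _ ()) , (λ _ ()) , (λ _ ())

  ∈M𝔭^-resp : ∀ {n A B} → A ≈M B → A ∈M𝔭^ n → B ∈M𝔭^ n
  ∈M𝔭^-resp (p , q , r , s) (a , b , c , d) = ∈𝔭^-resp p a , ∈𝔭^-resp q b , ∈𝔭^-resp r c , ∈𝔭^-resp s d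

  ∈M𝔭^-≤ : ∀ {m n A} → m ≤ n → A ∈M𝔭^ n → A ∈M𝔭^ m
  ∈M𝔭^-≤ m≤n (a , b , c , d) = ∈𝔭^-≤ m≤n a , ∈𝔭^-≤ m≤n b , ∈𝔭^-≤ m≤n c , ∈𝔭^-≤ m≤n d

  +M-∈M𝔭^ : ∀ {n A B} → A ∈M𝔭^ n → B ∈M𝔭^ n → (A +M B) ∈M𝔭^ n
  +M-∈M𝔭^ (a , b , c , d) (a′ , b′ , c′ , d′) = +R-∈𝔭^ a a′ , +R-∈𝔭^ b b′ , +R-∈𝔭^ c c′ , +R-∈𝔭^ d d′

  -M-∈M𝔭^ : ∀ {n A B} → A ∈M𝔭^ n → B ∈M𝔭^ n → (A -M B) ∈M𝔭^ n
  -M-∈M𝔭^ (a , b , c , d) (a′ , b′ , c′ , d′) = -R-∈𝔭^ a a′ , -R-∈𝔭^ b b′ , -R-∈𝔭^ c c′ , -R-∈𝔭^ d d′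

  -M-∈M𝔭^-suc : ∀ {n A B} → A ∈M𝔭^ n → B ∈M𝔭^ n → coeff n A ≈F coeff n B → (A -M B) ∈M𝔭^ suc n
  -M-∈M𝔭^-suc (a , b , c , d) (a′ , b′ , c′ , d′) (p , q , r , s) =
    -R-∈𝔭^-suc a a′ p , -R-∈𝔭^-suc b b′ q , -R-∈𝔭^-suc c c′ r , -R-∈𝔭^-suc d d′ s

  *M-∈M𝔭^ : ∀ a b {A B} → A ∈M𝔭^ a → B ∈M𝔭^ b → (A *M B) ∈M𝔭^ (a + b)
  *M-∈M𝔭^ a b (p , q , r , s) (p′ , q′ , r′ , s′) =
    +R-∈𝔭^ (*R-∈𝔭^ a b p p′) (*R-∈𝔭^ a b q r′) , +R-∈𝔭^ (*R-∈𝔭^ a b p q′) (*R-∈𝔭^ a b q s′) ,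
    +R-∈𝔭^ (*R-∈𝔭^ a b r p′) (*R-∈𝔭^ a b s r′) , +R-∈𝔭^ (*R-∈𝔭^ a b r q′) (*R-∈𝔭^ a b s s′)

  *M-leading : ∀ a b {A B} → A ∈M𝔭^ a → B ∈M𝔭^ b → coeff (a + b) (A *M B) ≈F (coeff a A *F coeff b B)
  *M-leading a b (p , q , r , s) (p′ , q′ , r′ , s′) =
    +-cong (*R-leading a b p p′) (*R-leading a b q r′) , +-cong (*R-leading a b p q′) (*R-leading a b q s′) ,
    +-cong (*R-leading a b r p′) (*R-leading a b s r′) , +-cong (*R-leading a b r q′) (*R-leading a b s s′)
    where open FiniteField 𝔽 using (_+_)

  coeff-cong : ∀ n {A B} → A ≈M B → coeff n A ≈F coeff n B
  coeff-cong n (p , q , r , s) = p n , q n , r n , s n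

  coeff-below : ∀ {m n A} → m < n → A ∈M𝔭^ n → coeff m A ≈F MF.0₂
  coeff-below {m} m<n (a , b , c , d) = a m m<n , b m m<n , c m m<n , d m m<n

  commutator-∈M𝔭^ : ∀ k m {A B} → A ∈M𝔭^ k → B ∈M𝔭^ m → (A *M B -M B *M A) ∈M𝔭^ (k + m)
  commutator-∈M𝔭^ k m {A} {B} A∈ B∈ =
    -M-∈M𝔭^ (*M-∈M𝔭^ k m A∈ B∈) (≡.subst (B *M A ∈M𝔭^_) (ℕ.+-comm m k) (*M-∈M𝔭^ m k B∈ A∈))

  commutator-leading : ∀ k m {A B} → A ∈M𝔭^ k → B ∈M𝔭^ m →
    coeff (k + m) (A *M B -M B *M A) ≈F (coeff k A *F coeff m B -F coeff m B *F coeff k A)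
  commutator-leading k m {A} {B} A∈ B∈ = MF.-₂-cong (*M-leading k m A∈ B∈)
    (≡.subst (λ n → coeff n (B *M A) ≈F (coeff m B *F coeff k A)) (ℕ.+-comm m k) (*M-leading m k B∈ A∈))

  reduce-* : ∀ A B → reduce (A *M B) ≈F (reduce A *F reduce B)
  reduce-* A B = *M-leading 0 0 (∈M𝔭^-zero A) (∈M𝔭^-zero B)

  infix 4 _≡1+π^_·_
  _≡1+π^_·_ : Mat → ℕ → MatF → Set ℓ
  D ≡1+π^ n · X = (D -M IM) ∈M𝔭^ n × coeff n (D -M IM) ≈F X

  ≡1+π^-rebase : ∀ n {a A X} → (A -M a) ∈M𝔭^ suc n → A ≡1+π^ n · X → a ≡1+π^ n · X
  ≡1+π^-rebase n {a} {A} {X} A-a∈ (A-1∈ , A-1≈X) =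
    ∈M𝔭^-resp (M.≈₂-sym rebase) (-M-∈M𝔭^ A-1∈ (∈M𝔭^-≤ (ℕ.n≤1+n n) A-a∈)) ,
    MF.≈₂-trans (coeff-cong n rebase) (MF.≈₂-trans (MF.-₂-cong A-1≈X (coeff-below ℕ.≤-refl A-a∈)) (MF.-₂-identityʳ X))
    where
    rebase : (a -M IM) ≈M ((A -M IM) -M (A -M a))
    rebase = M.-1-rebase a A

  det-reduce : ∀ A → det A 0 ≈ detF (reduce A)
  det-reduce A = +-cong (+-identityˡ _) (-‿cong (+-identityˡ _))

  diag[1+π,1] : Mat
  diag[1+π,1] = mat (1R +R πR) 0R 0R 1R

  diag[1+π,1]∈GL₂ : InGL₂ diag[1+π,1]
  diag[1+π,1]∈GL₂ = let u , [1+π]u≈1 = 1+π-isUnit in u , 𝓡.trans (𝓡.*-cong det≈1+π (𝓡.refl {u})) [1+π]u≈1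
    where
    module 𝓡 = CommutativeRing R-commutativeRing
    open IntegerCoefficientSolver R-commutativeRing using (solve; _:=_; _:+_; _:*_; _:-_; 1ₚ; 0ₚ)
    det≈1+π : det diag[1+π,1] ≈R (1R +R πR)
    det≈1+π = solve 1 (λ q → (1ₚ :+ q) :* 1ₚ :- 0ₚ :* 0ₚ := 1ₚ :+ q) 𝓡.refl πR

  diag[1+π,1]≡ : diag[1+π,1] ≡1+π^ 1 · MF.E₁₁
  diag[1+π,1]≡ =
    (∈𝔭^1 (trans (+-congʳ (+-identityʳ 1#)) (-‿inverseʳ 1#)) , ∈𝔭^1 (-‿inverseʳ 0#) ,
     ∈𝔭^1 (-‿inverseʳ 0#) , ∈𝔭^1 (-‿inverseʳ 1#)) ,
    (trans (+-cong (+-identityˡ 1#) -0#≈0#) (+-identityʳ 1#) , -‿inverseʳ 0# , -‿inverseʳ 0# , -‿inverseʳ 0#)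
    where
    open FiniteField 𝔽 using (_+_)
    open import Algebra.Properties.Ring ring using (-0#≈0#)

  I+π·≡ : ∀ B → (IM +M π· B) ≡1+π^ 1 · reduce B
  I+π·≡ B = (shift (e₁₁ B) , shift (e₁₂ B) , shift (e₂₁ B) , shift (e₂₂ B)) ,
            (leading {1R} (e₁₁ B) , leading {0R} (e₁₂ B) , leading {0R} (e₂₁ B) , leading {1R} (e₂₂ B))
    where
    open import Algebra.Properties.AbelianGroup +-abelianGroup using (xyx⁻¹≈y)
    shift : ∀ {u} f → ((u +R (πR *R f)) -R u) ∈𝔭^ 1
    shift f = ∈𝔭^1 (trans (xyx⁻¹≈y _ _) (πR*-zero f))
    leading : ∀ {u} f → ((u +R (πR *R f)) -R u) 1 ≈ f 0
    leading f = trans (xyx⁻¹≈y _ _) (πR*-suc 0 f)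

  ≡mod⇒-∈M𝔭^ : ∀ {k A B} → B ≡M A [mod𝔭^ k ] → (A -M B) ∈M𝔭^ k
  ≡mod⇒-∈M𝔭^ (p , q , r , s) = agree p , agree q , agree r , agree s
    where
    open import Algebra.Properties.Group +-group using (x≈y⇒x∙y⁻¹≈ε)
    agree : ∀ {k f g} → g ≡R f [mod𝔭^ k ] → (f -R g) ∈𝔭^ k
    agree g≡f m m<k = x≈y⇒x∙y⁻¹≈ε (sym (g≡f m m<k))

module FiniteFieldFacts {c ℓ} (𝔽 : FiniteField c ℓ) where
  open FiniteField 𝔽 renaming (Carrier to F) hiding (zero)
  open Inverse counting using (to; from; to-cong; strictlyInverseˡ)
  open import Algebra.Properties.Ring ring using (x+x≈x⇒x≈0)

  private
    open import Data.Fin using (zero; suc)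

    Fin-avoid-two : ∀ {n} → 2 ℕ.< n → (a b : Fin n) → ∃ λ k → k ≢ a × k ≢ b
    Fin-avoid-two (s≤s (s≤s (s≤s _))) zero          zero          = suc zero , (λ ()) , (λ ())
    Fin-avoid-two (s≤s (s≤s (s≤s _))) zero          (suc zero)    = suc (suc zero) , (λ ()) , (λ ())
    Fin-avoid-two (s≤s (s≤s (s≤s _))) zero          (suc (suc b)) = suc zero , (λ ()) , (λ ())
    Fin-avoid-two (s≤s (s≤s (s≤s _))) (suc zero)    zero          = suc (suc zero) , (λ ()) , (λ ())
    Fin-avoid-two (s≤s (s≤s (s≤s _))) (suc (suc a)) zero          = suc zero , (λ ()) , (λ ())
    Fin-avoid-two (s≤s (s≤s (s≤s _))) (suc a)       (suc b)       = zero , (λ ()) , (λ ())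

    Fin2-dichotomy : ∀ {n} → n ≡ 2 → (a b c : Fin n) → a ≢ b → c ≡ a ⊎ c ≡ b
    Fin2-dichotomy ≡.refl zero       zero       _          a≢b = ⊥-elim (a≢b ≡.refl)
    Fin2-dichotomy ≡.refl (suc zero) (suc zero) _          a≢b = ⊥-elim (a≢b ≡.refl)
    Fin2-dichotomy ≡.refl zero       (suc zero) zero       _   = inj₁ ≡.refl
    Fin2-dichotomy ≡.refl zero       (suc zero) (suc zero) _   = inj₂ ≡.refl
    Fin2-dichotomy ≡.refl (suc zero) zero       zero       _   = inj₂ ≡.refl
    Fin2-dichotomy ≡.refl (suc zero) zero       (suc zero) _   = inj₁ ≡.refl

  to-injective : ∀ {x y} → to x ≡ to y → x ≈ y
  to-injective = Injection.injective (Inverse⇒Injection counting)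

  infix 4 _≟_
  _≟_ : ∀ x y → Dec (x ≈ y)
  x ≟ y = map′ to-injective to-cong (to x Data.Fin.≟ to y)

  size-cases : 2 ℕ.< size ⊎ size ≡ 2
  size-cases = cases size (to 0#) (to 1#) (0≉1 ∘ to-injective)
    where
    cases : ∀ n (i j : Fin n) → i ≢ j → 2 ℕ.< n ⊎ n ≡ 2
    cases 1                   zero zero i≢j = ⊥-elim (i≢j ≡.refl)
    cases 2                   _    _    _   = inj₂ ≡.refl
    cases (suc (suc (suc n))) _    _    _   = inj₁ (s≤s (s≤s (s≤s z≤n)))

  avoid-two : 2 ℕ.< size → ∀ u v → Σ F λ y → ¬ y ≈ u × ¬ y ≈ v
  avoid-two 2<size u v =
    let k , k≢u , k≢v = Fin-avoid-two 2<size (to u) (to v) in from k , k≢u ∘ landing , k≢v ∘ landing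
    where
    landing : ∀ {k x} → from k ≈ x → k ≡ to x
    landing {k} from-k≈x = ≡.trans (≡.sym (strictlyInverseˡ k)) (to-cong from-k≈x)

  size≡2⇒0-or-1 : size ≡ 2 → ∀ x → x ≈ 0# ⊎ x ≈ 1#
  size≡2⇒0-or-1 size≡2 x =
    ⊎.map to-injective to-injective (Fin2-dichotomy size≡2 (to 0#) (to 1#) (to x) (0≉1 ∘ to-injective))

  size≡2⇒1+1≈0 : size ≡ 2 → 1# + 1# ≈ 0#
  size≡2⇒1+1≈0 size≡2 with size≡2⇒0-or-1 size≡2 (1# + 1#)
  ... | inj₁ 1+1≈0 = 1+1≈0
  ... | inj₂ 1+1≈1 = ⊥-elim (0≉1 (sym (x+x≈x⇒x≈0 1# 1+1≈1)))

  x*y≈1⇒x≉0 : ∀ {x y} → x * y ≈ 1# → ¬ x ≈ 0#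
  x*y≈1⇒x≉0 {x} {y} xy≈1 x≈0 = 0≉1 (trans (sym (trans (*-congʳ x≈0) (zeroˡ y))) xy≈1)

  *-nonzero : ∀ {x y} → ¬ x ≈ 0# → ¬ y ≈ 0# → ¬ x * y ≈ 0#
  *-nonzero {x} {y} x≉0 y≉0 xy≈0 = y≉0 (begin
    y                  ≈⟨ *-identityˡ y ⟨
    1# * y             ≈⟨ *-congʳ x⁻¹x≈1 ⟨
    (x⁻¹ * x) * y      ≈⟨ *-assoc x⁻¹ x y ⟩
    x⁻¹ * (x * y)      ≈⟨ *-congˡ xy≈0 ⟩
    x⁻¹ * 0#           ≈⟨ zeroʳ x⁻¹ ⟩
    0#                 ∎)
    where
    open ≈-Reasoning setoid
    x⁻¹ = proj₁ (inverse x x≉0)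
    x⁻¹x≈1 = trans (*-comm x⁻¹ x) (proj₂ (inverse x x≉0))

module Levels {c ℓ p} (𝔽 : FiniteField c ℓ) (G : PowerSeries.Mat 𝔽 → Set p) (SG : PowerSeries.IsSubgroupGL₂ 𝔽 G) where
  open import Data.Nat using (_+_)
  open FiniteField 𝔽 renaming (Carrier to F) hiding (_+_)
  open PowerSeries 𝔽
  open PowerSeriesRing 𝔽
  open Valuation 𝔽
  open MatrixValuation 𝔽
  open IsSubgroupGL₂ SG
  private module 𝓡 = CommutativeRing R-commutativeRing

  LiftsAtLevel : ℕ → MatF → Set (c ⊔ ℓ ⊔ p)
  LiftsAtLevel n X = Σ Mat λ D → G D × InSL₂ D × D ≡1+π^ n · X

  LiftsAtLevel-resp : ∀ {n X Y} → X ≈F Y → LiftsAtLevel n X → LiftsAtLevel n Y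
  LiftsAtLevel-resp X≈Y (D , D∈G , detD≈1 , D-1∈ , D-1≈X) = D , D∈G , detD≈1 , D-1∈ , MF.≈₂-trans D-1≈X X≈Y

  reduce≈1 : ∀ {D} → (D -M IM) ∈M𝔭^ 1 → reduce D ≈F IF
  reduce≈1 (a , b , c , d) =
    x∙y⁻¹≈ε⇒x≈y _ _ (a 0 0<1) , x∙y⁻¹≈ε⇒x≈y _ _ (b 0 0<1) , x∙y⁻¹≈ε⇒x≈y _ _ (c 0 0<1) , x∙y⁻¹≈ε⇒x≈y _ _ (d 0 0<1)
    where
    0<1 = s≤s z≤n
    open import Algebra.Properties.Group +-group using (x∙y⁻¹≈ε⇒x≈y)

  -- (Da)⁻¹aD − 1 = (Da)⁻¹((a − 1)(D − 1) − (D − 1)(a − 1)).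
  commutator-level : ∀ k m {a D P Y H} → G a → G D → a ≡1+π^ k · P → D ≡1+π^ m · Y →
    (reduce (D *M a) *F H) ≈F IF → LiftsAtLevel (k + m) (H *F (P *F Y -F Y *F P))
  commutator-level k m {a} {D} {P} {Y} {H} a∈G D∈G (a-1∈ , a-1≈P) (D-1∈ , D-1≈Y) DaH≈1
    with inv (mul D∈G a∈G)
  ... | V′ , V′∈G , _ , V′Da≈1 = V′ *M (a *M D) , mul V′∈G (mul a∈G D∈G) , det≈1 , level , leading
    where
    Q : Mat
    Q = (a -M IM) *M (D -M IM) -M (D -M IM) *M (a -M IM)
    expand : (V′ *M (a *M D) -M IM) ≈M (V′ *M Q)
    expand = begin
      V′ *M (a *M D) -M IM                ≈⟨ M.-₂-cong M.≈₂-refl (M.≈₂-sym V′Da≈1) ⟩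
      V′ *M (a *M D) -M V′ *M (D *M a)    ≈⟨ M.*₂-distribˡ-₂ V′ (a *M D) (D *M a) ⟩
      V′ *M (a *M D -M D *M a)            ≈⟨ M.*₂-cong M.≈₂-refl (M.*₂-comm-expand a D) ⟩
      V′ *M Q                             ∎
      where open ≈-Reasoning M.setoid₂
    Q∈ : Q ∈M𝔭^ (k + m)
    Q∈ = commutator-∈M𝔭^ k m a-1∈ D-1∈
    reduceV′≈H : reduce V′ ≈F H
    reduceV′≈H = MF.inverse-unique (MF.≈₂-trans (MF.≈₂-sym (reduce-* V′ (D *M a))) (coeff-cong 0 V′Da≈1)) DaH≈1
    level : (V′ *M (a *M D) -M IM) ∈M𝔭^ (k + m)
    level = ∈M𝔭^-resp (M.≈₂-sym expand) (*M-∈M𝔭^ 0 (k + m) (∈M𝔭^-zero V′) Q∈)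
    leading : coeff (k + m) (V′ *M (a *M D) -M IM) ≈F (H *F (P *F Y -F Y *F P))
    leading = MF.≈₂-trans (coeff-cong (k + m) expand) (MF.≈₂-trans (*M-leading 0 (k + m) (∈M𝔭^-zero V′) Q∈)
                (MF.*₂-cong reduceV′≈H (MF.≈₂-trans (commutator-leading k m a-1∈ D-1∈)
                  (MF.-₂-cong (MF.*₂-cong a-1≈P D-1≈Y) (MF.*₂-cong D-1≈Y a-1≈P)))))
    det≈1 : InSL₂ (V′ *M (a *M D))
    det≈1 = 𝓡.trans (M.det₂-* V′ (a *M D)) (𝓡.trans (𝓡.*-congˡ (M.det₂-*-comm a D)) (M.det₂-inverse {D *M a} {V′} V′Da≈1))

  LiftsAtLevel-+ : ∀ k {X Y} → LiftsAtLevel (suc k) X → LiftsAtLevel (suc k) Y → LiftsAtLevel (suc k) (X +F Y)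
  LiftsAtLevel-+ k {X} {Y} (D , D∈G , detD≈1 , D-1∈ , D-1≈X) (E , E∈G , detE≈1 , E-1∈ , E-1≈Y) =
    D *M E , mul D∈G E∈G , det≈1 , level , leading
    where
    expand = M.*₂-1-expand D E
    product∈ : ((D -M IM) *M (E -M IM)) ∈M𝔭^ (suc k + suc k)
    product∈ = *M-∈M𝔭^ (suc k) (suc k) D-1∈ E-1∈
    level : (D *M E -M IM) ∈M𝔭^ suc k
    level = ∈M𝔭^-resp (M.≈₂-sym expand) (+M-∈M𝔭^ (+M-∈M𝔭^ D-1∈ E-1∈) (∈M𝔭^-≤ (ℕ.m≤m+n (suc k) (suc k)) product∈))
    leading : coeff (suc k) (D *M E -M IM) ≈F (X +F Y)
    leading = MF.≈₂-trans (coeff-cong (suc k) expand)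
      (MF.≈₂-trans (MF.+₂-cong (MF.+₂-cong D-1≈X E-1≈Y) (coeff-below (ℕ.m<m+n (suc k) (s≤s z≤n)) product∈))
        (MF.+₂-identityʳ (X +F Y)))
    det≈1 : InSL₂ (D *M E)
    det≈1 = 𝓡.trans (M.det₂-* D E) (𝓡.trans (𝓡.*-cong detD≈1 detE≈1) (𝓡.*-identityˡ 1R))

  conjugation-level : ∀ m {D Y a h H} → G D → D ≡1+π^ suc m · Y → G a → reduce a ≈F h → (h *F H) ≈F IF →
    LiftsAtLevel (suc m) (H *F ((h -F IF) *F Y -F Y *F (h -F IF)))
  conjugation-level m {D = D} {a = a} {h = h} {H = H} D∈G D≡ a∈G a≈h hH≈1 =
    commutator-level 0 (suc m) a∈G D∈G (∈M𝔭^-zero (a -M IM) , MF.-₂-cong a≈h MF.≈₂-refl) D≡ DaH≈1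
    where
    DaH≈1 : (reduce (D *M a) *F H) ≈F IF
    DaH≈1 = MF.≈₂-trans
      (MF.*₂-cong (MF.≈₂-trans (reduce-* D a) (MF.*₂-cong (reduce≈1 (∈M𝔭^-≤ (s≤s z≤n) (proj₁ D≡))) a≈h)) MF.≈₂-refl)
              (MF.≈₂-trans (MF.*₂-cong (MF.*₂-identityˡ h) MF.≈₂-refl) hH≈1)

  bracket-level : ∀ m {a D P Y} → G a → a ≡1+π^ 1 · P → G D → D ≡1+π^ suc m · Y →
    LiftsAtLevel (suc (suc m)) (P *F Y -F Y *F P)
  bracket-level m {a} {D} a∈G a≡ D∈G D≡ =
    LiftsAtLevel-resp (MF.*₂-identityˡ _) (commutator-level 1 (suc m) a∈G D∈G a≡ D≡ DaI≈1)
    where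
    DaI≈1 : (reduce (D *M a) *F IF) ≈F IF
    DaI≈1 = MF.≈₂-trans (MF.*₂-identityʳ _) (MF.≈₂-trans (reduce-* D a)
              (MF.≈₂-trans (MF.*₂-cong (reduce≈1 (∈M𝔭^-≤ (s≤s z≤n) (proj₁ D≡))) (reduce≈1 (proj₁ a≡))) (MF.*₂-identityˡ IF)))

  -- Compare coefficients of πᵏ⁺¹ in det C = 1 + tr (C − 1) + det (C − 1), where det (C − 1) ∈ 𝔭²ᵏ⁺².
  SL-level-traceless : ∀ k {C} → InSL₂ C → (C -M IM) ∈M𝔭^ suc k → MF.tr₂ (coeff (suc k) (C -M IM)) ≈ 0#
  SL-level-traceless k {C} detC≈1 (a , b , c , d) =
    trans (sym (+-identityˡ _)) (trans (sym (+-identityʳ _)) (trans (+-congˡ (sym detE-vanishes))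
      (trans (sym (M.det₂-1-expand C (suc k))) (detC≈1 (suc k)))))
    where
    detE = M.det₂ (C -M IM)
    detE-vanishes : detE (suc k) ≈ 0#
    detE-vanishes = -R-∈𝔭^ (*R-∈𝔭^ (suc k) (suc k) a d) (*R-∈𝔭^ (suc k) (suc k) b c) (suc k) (ℕ.m<m+n (suc k) (s≤s z≤n))

  ApproximatesGL₂ : ℕ → Set (c ⊔ ℓ ⊔ p)
  ApproximatesGL₂ n = ∀ A → InGL₂ A → Σ Mat λ B → G B × (A -M B) ∈M𝔭^ n × det B ≈R det A

  -- With C = B⁻¹A ≡ 1 + πᵏ⁺¹X and D a lift of X: A − BD = B((C − 1) − (D − 1)) ∈ 𝔭ᵏ⁺².
  refine-approximation : ∀ k {A B} → (∀ X → MF.tr₂ X ≈ 0# → LiftsAtLevel (suc k) X) →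
    G B → (A -M B) ∈M𝔭^ suc k → det B ≈R det A →
    Σ Mat λ B₊ → G B₊ × (A -M B₊) ∈M𝔭^ suc (suc k) × det B₊ ≈R det A
  refine-approximation k {A} {B} lifts B∈G A-B∈ detB≈detA = using-inverse (inv B∈G)
    where
    using-inverse : Σ Mat (λ B′ → G B′ × (B *M B′) ≈M IM × (B′ *M B) ≈M IM) →
                    Σ Mat λ B₊ → G B₊ × (A -M B₊) ∈M𝔭^ suc (suc k) × det B₊ ≈R det A
    using-inverse (B′ , B′∈G , BB′≈1 , B′B≈1) = correct-by (lifts _ (SL-level-traceless k {C} detC≈1 C-1∈))
      where
      C : Mat
      C = B′ *M A
      C-1≈ : (C -M IM) ≈M (B′ *M (A -M B))
      C-1≈ = M.≈₂-trans (M.-₂-cong M.≈₂-refl (M.≈₂-sym B′B≈1)) (M.*₂-distribˡ-₂ B′ A B)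
      C-1∈ : (C -M IM) ∈M𝔭^ suc k
      C-1∈ = ∈M𝔭^-resp (M.≈₂-sym C-1≈) (*M-∈M𝔭^ 0 (suc k) (∈M𝔭^-zero B′) A-B∈)
      detC≈1 : InSL₂ C
      detC≈1 = 𝓡.trans (M.det₂-* B′ A) (𝓡.trans (𝓡.*-congˡ (𝓡.sym detB≈detA)) (M.det₂-inverse {B} {B′} B′B≈1))
      BC≈A : (B *M C) ≈M A
      BC≈A = begin
        B *M (B′ *M A)   ≈⟨ M.*₂-assoc B B′ A ⟨
        (B *M B′) *M A   ≈⟨ M.*₂-cong BB′≈1 (M.≈₂-refl {A}) ⟩
        IM *M A          ≈⟨ M.*₂-identityˡ A ⟩
        A                ∎
        where open ≈-Reasoning M.setoid₂
      correct-by : LiftsAtLevel (suc k) (coeff (suc k) (C -M IM)) →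
                   Σ Mat λ B₊ → G B₊ × (A -M B₊) ∈M𝔭^ suc (suc k) × det B₊ ≈R det A
      correct-by (D , D∈G , detD≈1 , D-1∈ , D-1≈) = B *M D , mul B∈G D∈G , A-BD∈ , detBD≈detA
        where
        A-BD≈ : (A -M B *M D) ≈M (B *M ((C -M IM) -M (D -M IM)))
        A-BD≈ = M.≈₂-trans (M.-₂-cong (M.≈₂-sym BC≈A) M.≈₂-refl)
                  (M.≈₂-trans (M.*₂-distribˡ-₂ B C D) (M.*₂-cong M.≈₂-refl (M.-₂-via-1 C D)))
        A-BD∈ : (A -M B *M D) ∈M𝔭^ suc (suc k)
        A-BD∈ = ∈M𝔭^-resp (M.≈₂-sym A-BD≈)
                  (*M-∈M𝔭^ 0 (suc (suc k)) (∈M𝔭^-zero B) (-M-∈M𝔭^-suc C-1∈ D-1∈ (MF.≈₂-sym D-1≈)))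
        detBD≈detA : det (B *M D) ≈R det A
        detBD≈detA = 𝓡.trans (M.det₂-* B D) (𝓡.trans (𝓡.*-cong detB≈detA detD≈1) (𝓡.*-identityʳ (det A)))

  approximation-step : ∀ k → (∀ X → MF.tr₂ X ≈ 0# → LiftsAtLevel (suc k) X) →
    ApproximatesGL₂ (suc k) → ApproximatesGL₂ (suc (suc k))
  approximation-step k lifts approx A A∈GL =
    let B , B∈G , A-B∈ , detB≈detA = approx A A∈GL in refine-approximation k lifts B∈G A-B∈ detB≈detA

  closed-from-approximations : IsClosed G → (∀ k → ApproximatesGL₂ (suc k)) → ∀ A → InGL₂ A → G A
  closed-from-approximations closed approx A A∈GL = closed A λ k → approximant k (approx k A A∈GL)
    where
    open import Algebra.Properties.Group +-group using (x∙y⁻¹≈ε⇒x≈y)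
    agree : ∀ {k f g} → (f -R g) ∈𝔭^ suc k → g ≡R f [mod𝔭^ k ]
    agree f-g∈ m m<k = sym (x∙y⁻¹≈ε⇒x≈y _ _ (f-g∈ m (ℕ.m<n⇒m<1+n m<k)))
    approximant : ∀ k → Σ Mat (λ B → G B × (A -M B) ∈M𝔭^ suc k × det B ≈R det A) →
                  Σ Mat λ B → G B × B ≡M A [mod𝔭^ k ]
    approximant k (B , B∈G , (a , b , c , d) , _) = B , B∈G , agree a , agree b , agree c , agree d

module SL₂Generation {c ℓ} (𝔽 : FiniteField c ℓ) where
  open FiniteField 𝔽 renaming (Carrier to F)
  open PowerSeries 𝔽 using (MatF; mat; e₂₁; _≈F_; _*F_; detF)
  open FiniteFieldFacts 𝔽
  open Matrices 𝔽
  open Over commRing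
  open IntegerCoefficientSolver commRing using (var; prove; _:-_; :-_; _:+_; _:*_; 1ₚ; 0ₚ)

  -- For c ≉ 0: mat a b c d = upper ((a − 1)/c) · lower c · upper ((d − 1)/c), a polynomial
  -- identity up to multiples of c c⁻¹ − 1 and ad − bc − 1. For c ≈ 0, first multiply by lower 1.
  elementary-generation : ∀ {r} (P : MatF → Set r) → (∀ {M N} → M ≈F N → P M → P N) →
    (∀ {M N} → P M → P N → P (M *F N)) → (∀ x → P (upper x)) → (∀ x → P (lower x)) →
    ∀ M → detF M ≈ 1# → P M
  elementary-generation P resp mul P-upper P-lower = generated
    where
    lower-left-invertible : ∀ M → ¬ e₂₁ M ≈ 0# → detF M ≈ 1# → P M
    lower-left-invertible (mat a b c d) c≉0 det≈1 = resp factorisation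
      (mul (mul (P-upper ((a - 1#) * c⁻¹)) (P-lower c)) (P-upper ((d - 1#) * c⁻¹)))
      where
      c⁻¹ = proj₁ (inverse c c≉0)
      cc⁻¹≈1 = proj₂ (inverse c c≉0)
      factorisation : (upper ((a - 1#) * c⁻¹) *F lower c *F upper ((d - 1#) * c⁻¹)) ≈F mat a b c d
      factorisation = ≈₂-trans
        (prove₂ (a ∷ b ∷ c ∷ d ∷ c⁻¹ ∷ [])
          (:upper ((𝐚 :- 1ₚ) :* 𝐜⁻¹) :*₂ :lower 𝐜 :*₂ :upper ((𝐝 :- 1ₚ) :* 𝐜⁻¹))
          (mat 𝐚 𝐛 𝐜 𝐝 :+₂ (𝐜 :* 𝐜⁻¹ :- 1ₚ) :·₂ mat (𝐚 :- 1ₚ) (𝐛 :+ 𝐜⁻¹ :* (𝐚 :- 1ₚ) :* (𝐝 :- 1ₚ)) 0ₚ (𝐝 :- 1ₚ)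
                       :+₂ (𝐚 :* 𝐝 :- 𝐛 :* 𝐜 :- 1ₚ) :·₂ mat 0ₚ 𝐜⁻¹ 0ₚ 0ₚ)
          (refl , refl , refl , refl))
        (≈₂-trans (+₂-vanishing _ (x≈y⇒x∙y⁻¹≈ε det≈1)) (+₂-vanishing (mat a b c d) (x≈y⇒x∙y⁻¹≈ε cc⁻¹≈1)))
        where
        open import Algebra.Properties.Group +-group using (x≈y⇒x∙y⁻¹≈ε)
        𝐚 = var (# 0)
        𝐛 = var (# 1)
        𝐜 = var (# 2)
        𝐝 = var (# 3)
        𝐜⁻¹ = var (# 4)

    generated : ∀ M → detF M ≈ 1# → P M
    generated (mat a b c d) det≈1 with c ≟ 0#
    ... | no  c≉0 = lower-left-invertible (mat a b c d) c≉0 det≈1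
    ... | yes c≈0 = resp undo (mul (P-lower (- 1#)) (lower-left-invertible (lower 1# *F mat a b c d) c′≉0 det′≈1))
      where
      open import Algebra.Properties.Ring ring using (-0#≈0#)
      ad≈1 : a * d ≈ 1#
      ad≈1 = trans (sym (trans (+-congˡ (trans (-‿cong (trans (*-congˡ c≈0) (zeroʳ b))) -0#≈0#)) (+-identityʳ _))) det≈1
      c′≉0 : ¬ 1# * a + 1# * c ≈ 0#
      c′≉0 c′≈0 = x*y≈1⇒x≉0 ad≈1
        (trans (sym (trans (+-cong (*-identityˡ a) (trans (*-identityˡ c) c≈0)) (+-identityʳ a))) c′≈0)
      det′≈1 : detF (lower 1# *F mat a b c d) ≈ 1#
      det′≈1 = trans (det₂-* (lower 1#) (mat a b c d)) (trans (*-cong det-lower det≈1) (*-identityˡ 1#))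
        where det-lower = prove [] (:det₂ (:lower 1ₚ)) 1ₚ refl
      undo : (lower (- 1#) *F (lower 1# *F mat a b c d)) ≈F mat a b c d
      undo = prove₂ (a ∷ b ∷ c ∷ d ∷ []) (:lower (:- 1ₚ) :*₂ (:lower 1ₚ :*₂ M)) M (refl , refl , refl , refl)
        where M = mat (var (# 0)) (var (# 1)) (var (# 2)) (var (# 3))

module ResidueLifts {c ℓ p} (𝔽 : FiniteField c ℓ) (G : PowerSeries.Mat 𝔽 → Set p)
    (SG : PowerSeries.IsSubgroupGL₂ 𝔽 G) (condB : PowerSeries.CondB 𝔽 G) where
  open FiniteField 𝔽 renaming (Carrier to F)
  open PowerSeries 𝔽
  open PowerSeriesRing 𝔽
  open MatrixValuation 𝔽
  open Levels 𝔽 G SG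
  open IsSubgroupGL₂ SG
  open FiniteFieldFacts 𝔽 using (x*y≈1⇒x≉0)
  open MF using (upper; lower; antidiag; prove₂; :upper; :lower; :antidiag; _:*₂_; :1₂)
  open IntegerCoefficientSolver commRing using (var)
  private module 𝓡 = CommutativeRing R-commutativeRing

  lift-invertible : ∀ {h H} → (h *F H) ≈F IF → Σ Mat λ a → G a × reduce a ≈F h
  lift-invertible {h} {H} hH≈1 = condB h (x*y≈1⇒x≉0 (MF.det₂-inverse {H} {h} hH≈1))

  InverseLifts : MatF → MatF → Set (c ⊔ ℓ ⊔ p)
  InverseLifts h H = Σ Mat λ a → Σ Mat λ a′ → G a × G a′ × reduce a ≈F h × reduce a′ ≈F H × (det a′ *R det a) ≈R 1R

  inverse-lifts : ∀ {h H} → (h *F H) ≈F IF → InverseLifts h H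
  inverse-lifts {h} {H} hH≈1 = let a , a∈G , a≈h = lift-invertible hH≈1 in with-inverse a a∈G a≈h (inv a∈G)
    where
    with-inverse : ∀ a → G a → reduce a ≈F h → Σ Mat (λ a′ → G a′ × (a *M a′) ≈M IM × (a′ *M a) ≈M IM) → InverseLifts h H
    with-inverse a a∈G a≈h (a′ , a′∈G , _ , a′a≈1) = a , a′ , a∈G , a′∈G , a≈h ,
      MF.inverse-unique (MF.≈₂-trans (MF.≈₂-sym (reduce-* a′ a)) (coeff-cong 0 a′a≈1))
                        (MF.≈₂-trans (MF.*₂-cong a≈h MF.≈₂-refl) hH≈1) ,
      M.det₂-inverse {a} {a′} a′a≈1

  LiftsToSL : MatF → Set (c ⊔ ℓ ⊔ p)
  LiftsToSL M = Σ Mat λ T → G T × InSL₂ T × reduce T ≈F M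

  LiftsToSL-resp : ∀ {M N} → M ≈F N → LiftsToSL M → LiftsToSL N
  LiftsToSL-resp M≈N (T , T∈G , detT≈1 , T≈M) = T , T∈G , detT≈1 , MF.≈₂-trans T≈M M≈N

  LiftsToSL-* : ∀ {M N} → LiftsToSL M → LiftsToSL N → LiftsToSL (M *F N)
  LiftsToSL-* (T , T∈G , detT≈1 , T≈M) (U , U∈G , detU≈1 , U≈N) =
    T *M U , mul T∈G U∈G , 𝓡.trans (M.det₂-* T U) (𝓡.trans (𝓡.*-cong detT≈1 detU≈1) (𝓡.*-identityˡ 1R)) ,
    MF.≈₂-trans (reduce-* T U) (MF.*₂-cong T≈M U≈N)

  conjugate-lifts : ∀ {h H M} → (h *F H) ≈F IF → LiftsToSL M → LiftsToSL (h *F M *F H)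
  conjugate-lifts hH≈1 (T , T∈G , detT≈1 , T≈M) =
    let a , a′ , a∈G , a′∈G , a≈h , a′≈H , deta′deta≈1 = inverse-lifts hH≈1 in
    a *M T *M a′ , mul (mul a∈G T∈G) a′∈G ,
    𝓡.trans (M.det₂-* (a *M T) a′) (𝓡.trans (𝓡.*-cong (M.det₂-* a T) (𝓡.refl {det a′}))
      (𝓡.trans (rearrange (det a) (det T) (det a′)) (𝓡.trans (𝓡.*-cong deta′deta≈1 detT≈1) (𝓡.*-identityˡ 1R)))) ,
    MF.≈₂-trans (reduce-* (a *M T) a′) (MF.*₂-cong (MF.≈₂-trans (reduce-* a T) (MF.*₂-cong a≈h T≈M)) a′≈H)
    where
    open IntegerCoefficientSolver R-commutativeRing using (solve; _:=_; _:*_)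
    rearrange : ∀ x y z → ((x *R y) *R z) ≈R ((z *R x) *R y)
    rearrange = solve 3 (λ x y z → x :* y :* z := (z :* x) :* y) 𝓡.refl

  commutator-lifts : ∀ {h H k K} → (h *F H) ≈F IF → (k *F K) ≈F IF → LiftsToSL ((h *F k) *F (H *F K))
  commutator-lifts hH≈1 kK≈1 =
    let a , a′ , a∈G , a′∈G , a≈h , a′≈H , deta′deta≈1 = inverse-lifts hH≈1
        b , b′ , b∈G , b′∈G , b≈k , b′≈K , detb′detb≈1 = inverse-lifts kK≈1 in
    (a *M b) *M (a′ *M b′) , mul (mul a∈G b∈G) (mul a′∈G b′∈G) ,
    𝓡.trans (M.det₂-* (a *M b) (a′ *M b′)) (𝓡.trans (𝓡.*-cong (M.det₂-* a b) (M.det₂-* a′ b′))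
      (𝓡.trans (rearrange (det a) (det b) (det a′) (det b′)) (𝓡.trans (𝓡.*-cong deta′deta≈1 detb′detb≈1) (𝓡.*-identityˡ 1R)))) ,
    MF.≈₂-trans (reduce-* (a *M b) (a′ *M b′))
      (MF.*₂-cong (MF.≈₂-trans (reduce-* a b) (MF.*₂-cong a≈h b≈k)) (MF.≈₂-trans (reduce-* a′ b′) (MF.*₂-cong a′≈H b′≈K)))
    where
    open IntegerCoefficientSolver R-commutativeRing using (solve; _:=_; _:*_)
    rearrange : ∀ x y z w → ((x *R y) *R (z *R w)) ≈R ((z *R x) *R (w *R y))
    rearrange = solve 4 (λ x y z w → (x :* y) :* (z :* w) := (z :* x) :* (w :* y)) 𝓡.refl

  lower-lifts : (∀ x → LiftsToSL (upper x)) → ∀ x → LiftsToSL (lower x)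
  lower-lifts upper-lifts x = LiftsToSL-resp conjugate (conjugate-lifts antidiag²≈1 (upper-lifts x))
    where
    antidiag²≈1 : (antidiag *F antidiag) ≈F IF
    antidiag²≈1 = prove₂ [] (:antidiag :*₂ :antidiag) :1₂ (refl , refl , refl , refl)
    conjugate : (antidiag *F upper x *F antidiag) ≈F lower x
    conjugate = prove₂ (x ∷ []) (:antidiag :*₂ :upper 𝐱 :*₂ :antidiag) (:lower 𝐱) (refl , refl , refl , refl)
      where 𝐱 = var (# 0)

  SL₂F-lifts : (∀ x → LiftsToSL (upper x)) → ∀ M → detF M ≈ 1# → LiftsToSL M
  SL₂F-lifts upper-lifts =
    SL₂Generation.elementary-generation 𝔽 LiftsToSL LiftsToSL-resp LiftsToSL-* upper-lifts (lower-lifts upper-lifts)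

  -- B = TE, where det E = det A by (a) and T ∈ G ∩ SL₂(R) lifts A E⁻¹ modulo π.
  approximates₁ : CondA G → (∀ M → detF M ≈ 1# → LiftsToSL M) → ApproximatesGL₂ 1
  approximates₁ condA lifts-SL₂ A A∈GL = with-det (condA (det A) A∈GL)
    where
    Approximant = Σ Mat λ B → G B × (A -M B) ∈M𝔭^ 1 × det B ≈R det A
    with-det : Σ Mat (λ E → G E × det E ≈R det A) → Approximant
    with-det (E , E∈G , detE≈detA) = with-inverse (inv E∈G)
      where
      with-inverse : Σ Mat (λ E′ → G E′ × (E *M E′) ≈M IM × (E′ *M E) ≈M IM) → Approximant
      with-inverse (E′ , E′∈G , _ , E′E≈1) = correct-by (lifts-SL₂ (reduce A *F reduce E′) detM≈1)
        where
        rE′rE≈1 : (reduce E′ *F reduce E) ≈F IF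
        rE′rE≈1 = MF.≈₂-trans (MF.≈₂-sym (reduce-* E′ E)) (coeff-cong 0 E′E≈1)
        detM≈1 : detF (reduce A *F reduce E′) ≈ 1#
        detM≈1 = begin
          detF (reduce A *F reduce E′)          ≈⟨ MF.det₂-* (reduce A) (reduce E′) ⟩
          detF (reduce A) * detF (reduce E′)    ≈⟨ *-congʳ detA≈detE ⟩
          detF (reduce E) * detF (reduce E′)    ≈⟨ *-comm _ _ ⟩
          detF (reduce E′) * detF (reduce E)    ≈⟨ MF.det₂-inverse {reduce E} {reduce E′} rE′rE≈1 ⟩
          1#                                    ∎
          where
          open ≈-Reasoning setoid
          detA≈detE : detF (reduce A) ≈ detF (reduce E)
          detA≈detE = trans (sym (det-reduce A)) (trans (sym (detE≈detA 0)) (det-reduce E))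
        correct-by : LiftsToSL (reduce A *F reduce E′) → Approximant
        correct-by (T , T∈G , detT≈1 , T≈M) = T *M E , mul T∈G E∈G , A-TE∈ , detTE≈detA
          where
          rTE≈rA : reduce (T *M E) ≈F reduce A
          rTE≈rA = begin
            reduce (T *M E)                         ≈⟨ reduce-* T E ⟩
            reduce T *F reduce E                    ≈⟨ MF.*₂-cong T≈M MF.≈₂-refl ⟩
            (reduce A *F reduce E′) *F reduce E     ≈⟨ MF.*₂-assoc (reduce A) (reduce E′) (reduce E) ⟩
            reduce A *F (reduce E′ *F reduce E)     ≈⟨ MF.*₂-cong MF.≈₂-refl rE′rE≈1 ⟩
            reduce A *F IF                          ≈⟨ MF.*₂-identityʳ (reduce A) ⟩
            reduce A                                ∎
            where open ≈-Reasoning MF.setoid₂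
          A-TE∈ : (A -M T *M E) ∈M𝔭^ 1
          A-TE∈ = -M-∈M𝔭^-suc (∈M𝔭^-zero A) (∈M𝔭^-zero (T *M E)) (MF.≈₂-sym rTE≈rA)
          detTE≈detA : det (T *M E) ≈R det A
          detTE≈detA = 𝓡.trans (M.det₂-* T E) (𝓡.trans (𝓡.*-cong detT≈1 detE≈detA) (𝓡.*-identityˡ (det A)))

module TracelessGeneration {c ℓ p} (𝔽 : FiniteField c ℓ) (G : PowerSeries.Mat 𝔽 → Set p)
    (SG : PowerSeries.IsSubgroupGL₂ 𝔽 G) (condB : PowerSeries.CondB 𝔽 G) where
  open FiniteField 𝔽 renaming (Carrier to F) hiding (_+_)
  open PowerSeries 𝔽
  open MatrixValuation 𝔽
  open Levels 𝔽 G SG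
  open ResidueLifts 𝔽 G SG condB using (lift-invertible)
  open MF using (E₁₂; E₂₁; lower; antidiag; tr₂; prove₂; :E₁₂; :E₂₁; :lower; :antidiag; _:*₂_; _:-₂_; _:+₂_; :1₂)
  open IntegerCoefficientSolver commRing using (var; :-_; 1ₚ; 0ₚ)

  conjugation-difference : ∀ k {D Y h H} → (h *F H) ≈F IF → G D → D ≡1+π^ suc k · Y →
    LiftsAtLevel (suc k) (H *F ((h -F IF) *F Y -F Y *F (h -F IF)))
  conjugation-difference k hH≈1 D∈G D≡ =
    let a , a∈G , a≈h = lift-invertible hH≈1 in conjugation-level k D∈G D≡ a∈G a≈h hH≈1

  lifts-conjugation-difference : ∀ k {Y h H} → (h *F H) ≈F IF → LiftsAtLevel (suc k) Y →
    LiftsAtLevel (suc k) (H *F ((h -F IF) *F Y -F Y *F (h -F IF)))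
  lifts-conjugation-difference k hH≈1 (D , D∈G , _ , D≡) = conjugation-difference k hH≈1 D∈G D≡

  module _ (k : ℕ) (E₁₂-lifts : ∀ x → LiftsAtLevel (suc k) (E₁₂ x)) where

    E₂₁-lifts : ∀ y → LiftsAtLevel (suc k) (E₂₁ y)
    E₂₁-lifts y = LiftsAtLevel-resp identity (LiftsAtLevel-+ k
      (lifts-conjugation-difference k antidiag²≈1 (E₁₂-lifts (- y))) (E₁₂-lifts y))
      where
      𝐲 = var (# 0)
      antidiag²≈1 : (antidiag *F antidiag) ≈F IF
      antidiag²≈1 = prove₂ [] (:antidiag :*₂ :antidiag) :1₂ (refl , refl , refl , refl)
      identity : (antidiag *F ((antidiag -F IF) *F E₁₂ (- y) -F E₁₂ (- y) *F (antidiag -F IF)) +F E₁₂ y) ≈F E₂₁ y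
      identity = prove₂ (y ∷ [])
        (:antidiag :*₂ ((:antidiag :-₂ :1₂) :*₂ :E₁₂ (:- 𝐲) :-₂ :E₁₂ (:- 𝐲) :*₂ (:antidiag :-₂ :1₂)) :+₂ :E₁₂ 𝐲)
        (:E₂₁ 𝐲) (refl , refl , refl , refl)

    diagonal-lifts : ∀ a → LiftsAtLevel (suc k) (mat a 0# 0# (- a))
    diagonal-lifts a = LiftsAtLevel-resp identity (LiftsAtLevel-+ k
      (lifts-conjugation-difference k lower1*lower-1≈1 (E₁₂-lifts (- a))) (E₂₁-lifts a))
      where
      𝐚 = var (# 0)
      lower1*lower-1≈1 : (lower 1# *F lower (- 1#)) ≈F IF
      lower1*lower-1≈1 = prove₂ [] (:lower 1ₚ :*₂ :lower (:- 1ₚ)) :1₂ (refl , refl , refl , refl)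
      identity : (lower (- 1#) *F ((lower 1# -F IF) *F E₁₂ (- a) -F E₁₂ (- a) *F (lower 1# -F IF)) +F E₂₁ a)
                 ≈F mat a 0# 0# (- a)
      identity = prove₂ (a ∷ [])
        (:lower (:- 1ₚ) :*₂ ((:lower 1ₚ :-₂ :1₂) :*₂ :E₁₂ (:- 𝐚) :-₂ :E₁₂ (:- 𝐚) :*₂ (:lower 1ₚ :-₂ :1₂)) :+₂ :E₂₁ 𝐚)
        (mat 𝐚 0ₚ 0ₚ (:- 𝐚)) (refl , refl , refl , refl)

    traceless-lifts : ∀ X → tr₂ X ≈ 0# → LiftsAtLevel (suc k) X
    traceless-lifts X@(mat a b c d) trX≈0 = LiftsAtLevel-resp identity
      (LiftsAtLevel-+ k (LiftsAtLevel-+ k (diagonal-lifts a) (E₁₂-lifts b)) (E₂₁-lifts c))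
      where
      open import Algebra.Properties.Group +-group using (inverseʳ-unique)
      identity : ((mat a 0# 0# (- a) +F E₁₂ b) +F E₂₁ c) ≈F X
      identity = MF.≈₂-trans
        (prove₂ (a ∷ b ∷ c ∷ []) ((mat 𝐚 0ₚ 0ₚ (:- 𝐚) :+₂ :E₁₂ 𝐛) :+₂ :E₂₁ 𝐜) (mat 𝐚 𝐛 𝐜 (:- 𝐚)) (refl , refl , refl , refl))
        (refl , refl , refl , sym (inverseʳ-unique a d trX≈0))
        where
        𝐚 = var (# 0)
        𝐛 = var (# 1)
        𝐜 = var (# 2)

module FromLevelOne {c ℓ p} (𝔽 : FiniteField c ℓ) (G : PowerSeries.Mat 𝔽 → Set p)
    (SG : PowerSeries.IsSubgroupGL₂ 𝔽 G) (closed : PowerSeries.IsClosed 𝔽 G) (condB : PowerSeries.CondB 𝔽 G) where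
  open FiniteField 𝔽 renaming (Carrier to F) hiding (_+_)
  open PowerSeries 𝔽
  open MatrixValuation 𝔽
  open Levels 𝔽 G SG
  open TracelessGeneration 𝔽 G SG condB
  open MF using (E₁₁; E₁₂; prove₂; :E₁₁; :E₁₂; _:*₂_; _:-₂_)

  module _ (E₁₂-lifts₁ : ∀ x → LiftsAtLevel 1 (E₁₂ x)) (approximates₁ : ApproximatesGL₂ 1) where

    private
      a₁ : Σ Mat λ a → G a × (diag[1+π,1] -M a) ∈M𝔭^ 2 × det a ≈R det diag[1+π,1]
      a₁ = approximation-step 0 (traceless-lifts 0 E₁₂-lifts₁) approximates₁ diag[1+π,1] diag[1+π,1]∈GL₂

      a₁≡ : proj₁ a₁ ≡1+π^ 1 · E₁₁
      a₁≡ = ≡1+π^-rebase 1 (proj₁ (proj₂ (proj₂ a₁))) diag[1+π,1]≡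

    E₁₂-lifts : ∀ k x → LiftsAtLevel (suc k) (E₁₂ x)
    E₁₂-lifts zero    = E₁₂-lifts₁
    E₁₂-lifts (suc k) x =
      let D , D∈G , _ , D≡ = E₁₂-lifts k x in
      LiftsAtLevel-resp [E₁₁,E₁₂]≈E₁₂ (bracket-level k (proj₁ (proj₂ a₁)) a₁≡ D∈G D≡)
      where
      open IntegerCoefficientSolver commRing using (var)
      [E₁₁,E₁₂]≈E₁₂ : (E₁₁ *F E₁₂ x -F E₁₂ x *F E₁₁) ≈F E₁₂ x
      [E₁₁,E₁₂]≈E₁₂ = prove₂ (x ∷ []) (:E₁₁ :*₂ :E₁₂ 𝐱 :-₂ :E₁₂ 𝐱 :*₂ :E₁₁) (:E₁₂ 𝐱) (refl , refl , refl , refl)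
        where 𝐱 = var (# 0)

    approximates : ∀ k → ApproximatesGL₂ (suc k)
    approximates zero    = approximates₁
    approximates (suc k) = approximation-step k (traceless-lifts k (E₁₂-lifts k)) (approximates k)

    everything-in-G : ∀ A → InGL₂ A → G A
    everything-in-G = closed-from-approximations closed approximates

module LargeResidueField {c ℓ p} (𝔽 : FiniteField c ℓ) (G : PowerSeries.Mat 𝔽 → Set p)
    (SG : PowerSeries.IsSubgroupGL₂ 𝔽 G) (condB : PowerSeries.CondB 𝔽 G)
    (2<size : 2 ℕ.< FiniteField.size 𝔽) where
  open FiniteField 𝔽 renaming (Carrier to F)
  open PowerSeries 𝔽
  open FiniteFieldFacts 𝔽
  open MatrixValuation 𝔽
  open Levels 𝔽 G SG
  open ResidueLifts 𝔽 G SG condB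
  open TracelessGeneration 𝔽 G SG condB
  open MF using (Matₚ; E₁₂; upper; prove₂; +₂-vanishing; _:*₂_; _:-₂_; _:+₂_; _:·₂_; :1₂; :E₁₁; :E₁₂; :upper)
  open IntegerCoefficientSolver commRing using (Polynomial; var; solve; _:=_; _:*_; _:-_; _:+_; :-_; 1ₚ; 0ₚ)
  open import Algebra.Properties.Group +-group using (x≈y⇒x∙y⁻¹≈ε; x∙y⁻¹≈ε⇒x≈y)

  private
    t : F
    t = proj₁ (avoid-two 2<size 0# 1#)
    t≉0 : ¬ t ≈ 0#
    t≉0 = proj₁ (proj₂ (avoid-two 2<size 0# 1#))
    t-1≉0 : ¬ t - 1# ≈ 0#
    t-1≉0 t-1≈0 = proj₂ (proj₂ (avoid-two 2<size 0# 1#)) (x∙y⁻¹≈ε⇒x≈y t 1# t-1≈0)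
    t⁻¹ [t-1]⁻¹ : F
    t⁻¹ = proj₁ (inverse t t≉0)
    [t-1]⁻¹ = proj₁ (inverse (t - 1#) t-1≉0)
    tt⁻¹-1≈0 : t * t⁻¹ - 1# ≈ 0#
    tt⁻¹-1≈0 = x≈y⇒x∙y⁻¹≈ε (proj₂ (inverse t t≉0))
    [t-1][t-1]⁻¹-1≈0 : (t - 1#) * [t-1]⁻¹ - 1# ≈ 0#
    [t-1][t-1]⁻¹-1≈0 = x≈y⇒x∙y⁻¹≈ε (proj₂ (inverse (t - 1#) t-1≉0))

    diag : F → MatF
    diag x = mat x 0# 0# 1#

    :diag : ∀ {n} → Polynomial n → Matₚ
    :diag x = mat x 0ₚ 0ₚ 1ₚ

    diag-inverse : ∀ {s r} → s * r ≈ 1# → (diag s *F diag r) ≈F IF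
    diag-inverse {s} {r} sr≈1 = MF.≈₂-trans
      (prove₂ (s ∷ r ∷ []) (:diag 𝐬 :*₂ :diag 𝐫) (:1₂ :+₂ (𝐬 :* 𝐫 :- 1ₚ) :·₂ :E₁₁) (refl , refl , refl , refl))
      (+₂-vanishing IF (x≈y⇒x∙y⁻¹≈ε sr≈1))
      where
      𝐬 = var (# 0)
      𝐫 = var (# 1)

    upper-inverse : ∀ y → (upper y *F upper (- y)) ≈F IF
    upper-inverse y = prove₂ (y ∷ []) (:upper 𝐲 :*₂ :upper (:- 𝐲)) :1₂ (refl , refl , refl , refl)
      where 𝐲 = var (# 0)

  -- upper x is the commutator of diag t and upper (x/(t − 1)), where t ∉ {0, 1} needs |𝔽| > 2.
  upper-lifts : ∀ x → LiftsToSL (upper x)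
  upper-lifts x = LiftsToSL-resp commutator≈
    (commutator-lifts (diag-inverse (proj₂ (inverse t t≉0))) (upper-inverse (x * [t-1]⁻¹)))
    where
    commutator≈ : ((diag t *F upper (x * [t-1]⁻¹)) *F (diag t⁻¹ *F upper (- (x * [t-1]⁻¹)))) ≈F upper x
    commutator≈ = MF.≈₂-trans
      (prove₂ (x ∷ t ∷ t⁻¹ ∷ [t-1]⁻¹ ∷ [])
        (((:diag 𝐭) :*₂ :upper (𝐱 :* 𝐬)) :*₂ ((:diag 𝐭⁻¹) :*₂ :upper (:- (𝐱 :* 𝐬))))
        (:upper 𝐱 :+₂ ((𝐭 :- 1ₚ) :* 𝐬 :- 1ₚ) :·₂ :E₁₂ 𝐱 :+₂ (𝐭 :* 𝐭⁻¹ :- 1ₚ) :·₂ mat 1ₚ (:- (𝐱 :* 𝐬)) 0ₚ 0ₚ)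
        (refl , refl , refl , refl))
      (MF.≈₂-trans (+₂-vanishing _ tt⁻¹-1≈0) (+₂-vanishing (upper x) [t-1][t-1]⁻¹-1≈0))
      where
      𝐱 = var (# 0)
      𝐭 = var (# 1)
      𝐭⁻¹ = var (# 2)
      𝐬 = var (# 3)

  private
    diagonal-conjugation : ∀ {D Z} → G D → D ≡1+π^ 1 · Z → e₂₁ Z ≈ 0# → ∀ {s r} → s * r ≈ 1# →
      LiftsAtLevel 1 (E₁₂ (r * ((s - 1#) * e₁₂ Z)))
    diagonal-conjugation {Z = Z@(mat a b c d)} D∈G D≡ c≈0 {s} {r} sr≈1 =
      LiftsAtLevel-resp conjugate≈ (conjugation-difference 0 {h = diag s} {H = diag r} (diag-inverse sr≈1) D∈G D≡)
      where
      conjugate≈ : (diag r *F ((diag s -F IF) *F Z -F Z *F (diag s -F IF))) ≈F E₁₂ (r * ((s - 1#) * b))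
      conjugate≈ = MF.≈₂-trans
        (prove₂ (a ∷ b ∷ c ∷ d ∷ s ∷ r ∷ [])
          ((:diag 𝐫) :*₂ (((:diag 𝐬) :-₂ :1₂) :*₂ mat 𝐚 𝐛 𝐜 𝐝 :-₂ mat 𝐚 𝐛 𝐜 𝐝 :*₂ ((:diag 𝐬) :-₂ :1₂)))
          (:E₁₂ (𝐫 :* ((𝐬 :- 1ₚ) :* 𝐛)) :+₂ 𝐜 :·₂ mat 0ₚ 0ₚ (:- (𝐬 :- 1ₚ)) 0ₚ)
          (refl , refl , refl , refl))
        (+₂-vanishing _ c≈0)
        where
        𝐚 = var (# 0)
        𝐛 = var (# 1)
        𝐜 = var (# 2)
        𝐝 = var (# 3)
        𝐬 = var (# 4)
        𝐫 = var (# 5)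

    -- For x ≉ τ, r = 1 − x/τ is invertible and E₁₂ τ − diag r · E₁₂ τ · diag r⁻¹ = E₁₂ ((1 − r) τ) = E₁₂ x.
    E₁₂-spread : ∀ {τ} → LiftsAtLevel 1 (E₁₂ τ) → ¬ τ ≈ 0# → ∀ x → LiftsAtLevel 1 (E₁₂ x)
    E₁₂-spread {τ} lift@(D , D∈G , _ , D≡) τ≉0 x with x ≟ τ
    ... | yes x≈τ = LiftsAtLevel-resp (refl , sym x≈τ , refl , refl) lift
    ... | no  x≉τ = LiftsAtLevel-resp scaled≈ (diagonal-conjugation D∈G D≡ refl sr≈1)
      where
      τ⁻¹ = proj₁ (inverse τ τ≉0)
      ττ⁻¹-1≈0 : τ * τ⁻¹ - 1# ≈ 0#
      ττ⁻¹-1≈0 = x≈y⇒x∙y⁻¹≈ε (proj₂ (inverse τ τ≉0))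
      r = 1# - x * τ⁻¹
      r≉0 : ¬ r ≈ 0#
      r≉0 r≈0 = x≉τ (begin
        x
          ≈⟨ solve 3 (λ x τ τ⁻¹ → x := τ :- (1ₚ :- x :* τ⁻¹) :* τ :- x :* (τ :* τ⁻¹ :- 1ₚ)) refl x τ τ⁻¹ ⟩
        τ - r * τ - x * (τ * τ⁻¹ - 1#)
          ≈⟨ +-cong (+-congˡ (-‿cong rτ≈0)) (-‿cong x[ττ⁻¹-1]≈0) ⟩
        τ - 0# - 0#
          ≈⟨ solve 1 (λ τ → τ :- 0ₚ :- 0ₚ := τ) refl τ ⟩
        τ ∎)
        where
        open ≈-Reasoning setoid
        rτ≈0 = trans (*-congʳ r≈0) (zeroˡ τ)
        x[ττ⁻¹-1]≈0 = trans (*-congˡ ττ⁻¹-1≈0) (zeroʳ x)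
      s = proj₁ (inverse r r≉0)
      sr≈1 : s * r ≈ 1#
      sr≈1 = trans (*-comm s r) (proj₂ (inverse r r≉0))
      scaled≈ : E₁₂ (r * ((s - 1#) * τ)) ≈F E₁₂ x
      scaled≈ = MF.≈₂-trans
        (prove₂ (x ∷ τ ∷ τ⁻¹ ∷ s ∷ [])
          (:E₁₂ ((1ₚ :- 𝐱 :* 𝛕⁻¹) :* ((𝐬 :- 1ₚ) :* 𝛕)))
          (:E₁₂ 𝐱 :+₂ ((1ₚ :- 𝐱 :* 𝛕⁻¹) :* 𝐬 :- 1ₚ) :·₂ :E₁₂ 𝛕 :+₂ (𝛕 :* 𝛕⁻¹ :- 1ₚ) :·₂ :E₁₂ 𝐱)
          (refl , refl , refl , refl))
        (MF.≈₂-trans (+₂-vanishing _ ττ⁻¹-1≈0) (+₂-vanishing (E₁₂ x) (x≈y⇒x∙y⁻¹≈ε (proj₂ (inverse r r≉0)))))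
        where
        𝐱 = var (# 0)
        𝛕 = var (# 1)
        𝛕⁻¹ = var (# 2)
        𝐬 = var (# 3)

    upper-conjugate : ∀ {g a b c d} → G g → g ≡1+π^ 1 · mat a b c d → ∀ y →
      LiftsAtLevel 1 (mat (y * c) (y * ((d - a) + c * y)) 0# (- (c * y)))
    upper-conjugate {a = a} {b} {c} {d} g∈G g≡ y =
      LiftsAtLevel-resp conjugate≈ (conjugation-difference 0 (upper-inverse y) g∈G g≡)
      where
      conjugate≈ : (upper (- y) *F ((upper y -F IF) *F mat a b c d -F mat a b c d *F (upper y -F IF)))
                   ≈F mat (y * c) (y * ((d - a) + c * y)) 0# (- (c * y))
      conjugate≈ = prove₂ (a ∷ b ∷ c ∷ d ∷ y ∷ [])
        (:upper (:- 𝐲) :*₂ ((:upper 𝐲 :-₂ :1₂) :*₂ mat 𝐚 𝐛 𝐜 𝐝 :-₂ mat 𝐚 𝐛 𝐜 𝐝 :*₂ (:upper 𝐲 :-₂ :1₂)))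
        (mat (𝐲 :* 𝐜) (𝐲 :* ((𝐝 :- 𝐚) :+ 𝐜 :* 𝐲)) 0ₚ (:- (𝐜 :* 𝐲)))
        (refl , refl , refl , refl)
        where
        𝐚 = var (# 0)
        𝐛 = var (# 1)
        𝐜 = var (# 2)
        𝐝 = var (# 3)
        𝐲 = var (# 4)

    Seed : Set (c ⊔ ℓ ⊔ p)
    Seed = Σ MatF λ Z → Σ Mat λ D → G D × D ≡1+π^ 1 · Z × e₂₁ Z ≈ 0# × ¬ e₁₂ Z ≈ 0#

    -- Unless Y is already upper triangular with nonzero (1,2) entry, upper-conjugate with a
    -- suitable y ≉ 0 works; here it matters that Y is not scalar.
    seed : ∀ {g Y} → G g → g ≡1+π^ 1 · Y → ¬ IsScalarF Y → Seed
    seed {g} {Y@(mat a b c d)} g∈G g≡ nonscalar with c ≟ 0# | b ≟ 0#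
    ... | yes c≈0 | no b≉0 = Y , g , g∈G , g≡ , c≈0 , b≉0
    ... | yes c≈0 | yes b≈0 =
      let D , D∈G , _ , D≡ = upper-conjugate g∈G g≡ 1# in _ , D , D∈G , D≡ , refl , nonzero
      where
      nonzero : ¬ 1# * ((d - a) + c * 1#) ≈ 0#
      nonzero z≈0 = nonscalar (b≈0 , c≈0 , sym (x∙y⁻¹≈ε⇒x≈y d a (begin
        d - a                              ≈⟨ solve 3 (λ a c d → d :- a := 1ₚ :* ((d :- a) :+ c :* 1ₚ) :- c) refl a c d ⟩
        1# * ((d - a) + c * 1#) - c        ≈⟨ +-cong z≈0 (-‿cong c≈0) ⟩
        0# - 0#                            ≈⟨ -‿inverseʳ 0# ⟩
        0#                                 ∎)))
        where open ≈-Reasoning setoid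
    ... | no c≉0 | _ =
      let D , D∈G , _ , D≡ = upper-conjugate g∈G g≡ y in _ , D , D∈G , D≡ , refl , *-nonzero y≉0 nonzero
      where
      c⁻¹ = proj₁ (inverse c c≉0)
      y = proj₁ (avoid-two 2<size 0# ((a - d) * c⁻¹))
      y≉0 = proj₁ (proj₂ (avoid-two 2<size 0# ((a - d) * c⁻¹)))
      nonzero : ¬ (d - a) + c * y ≈ 0#
      nonzero z≈0 = proj₂ (proj₂ (avoid-two 2<size 0# ((a - d) * c⁻¹))) (begin
        y
          ≈⟨ solve 5 (λ a c d y c⁻¹ → y := ((a :- d) :+ ((d :- a) :+ c :* y)) :* c⁻¹ :- y :* (c :* c⁻¹ :- 1ₚ))
                   refl a c d y c⁻¹ ⟩
        ((a - d) + ((d - a) + c * y)) * c⁻¹ - y * (c * c⁻¹ - 1#)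
          ≈⟨ +-cong (*-congʳ (+-congˡ z≈0)) (-‿cong y[cc⁻¹-1]≈0) ⟩
        ((a - d) + 0#) * c⁻¹ - 0#
          ≈⟨ solve 3 (λ a d c⁻¹ → ((a :- d) :+ 0ₚ) :* c⁻¹ :- 0ₚ := (a :- d) :* c⁻¹) refl a d c⁻¹ ⟩
        (a - d) * c⁻¹ ∎)
        where
        open ≈-Reasoning setoid
        y[cc⁻¹-1]≈0 = trans (*-congˡ (x≈y⇒x∙y⁻¹≈ε (proj₂ (inverse c c≉0)))) (zeroʳ y)

  E₁₂-lifts₁ : CondC G → ∀ x → LiftsAtLevel 1 (E₁₂ x)
  E₁₂-lifts₁ condC =
    let B , g∈G , nonscalar = condC 2<size
        Z , D , D∈G , D≡ , Z₂₁≈0 , Z₁₂≉0 = seed g∈G (I+π·≡ B) nonscalar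
    in E₁₂-spread (diagonal-conjugation D∈G D≡ Z₂₁≈0 (proj₂ (inverse t t≉0)))
                  (*-nonzero t⁻¹≉0 (*-nonzero t-1≉0 Z₁₂≉0))
    where
    t⁻¹≉0 : ¬ t⁻¹ ≈ 0#
    t⁻¹≉0 = x*y≈1⇒x≉0 (trans (*-comm t⁻¹ t) (proj₂ (inverse t t≉0)))

module TwoElementResidueField {c ℓ p} (𝔽 : FiniteField c ℓ) (G : PowerSeries.Mat 𝔽 → Set p)
    (SG : PowerSeries.IsSubgroupGL₂ 𝔽 G) (condB : PowerSeries.CondB 𝔽 G)
    (size≡2 : FiniteField.size 𝔽 ≡ 2) where
  open FiniteField 𝔽 renaming (Carrier to F)
  open PowerSeries 𝔽
  open FiniteFieldFacts 𝔽
  open Matrices 𝔽 using (map; map-*₂; map-det₂)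
  open MatrixValuation 𝔽
  open Levels 𝔽 G SG
  open ResidueLifts 𝔽 G SG condB
  open TracelessGeneration 𝔽 G SG condB
  open IsSubgroupGL₂ SG
  module 𝔹 = Matrices.Over 𝔽 xor-∧-commutativeRing
  open import Algebra.Properties.Ring ring using (-0#≈0#)
  open import Algebra.Properties.Group +-group using (inverseʳ-unique)

  -- Matrices over 𝔽 are transported to M₂(Bool), with xor and ∧, where they can be enumerated.
  private
    toF : Bool → F
    toF false = 0#
    toF true  = 1#

    toF-xor : ∀ x y → toF (x xor y) ≈ toF x + toF y
    toF-xor false y     = sym (+-identityˡ _)
    toF-xor true  false = sym (+-identityʳ 1#)
    toF-xor true  true  = sym (size≡2⇒1+1≈0 size≡2)

    toF-∧ : ∀ x y → toF (x ∧ y) ≈ toF x * toF y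
    toF-∧ false y     = sym (zeroˡ _)
    toF-∧ true  false = sym (zeroʳ 1#)
    toF-∧ true  true  = sym (*-identityˡ 1#)

    toF-self-inverse : ∀ x → toF x ≈ - toF x
    toF-self-inverse false = sym -0#≈0#
    toF-self-inverse true  = inverseʳ-unique 1# 1# (size≡2⇒1+1≈0 size≡2)

    toF-injective : ∀ {x y} → toF x ≈ toF y → x ≡ y
    toF-injective {false} {false} _ = ≡.refl
    toF-injective {false} {true}  0≈1 = ⊥-elim (0≉1 0≈1)
    toF-injective {true}  {false} 1≈0 = ⊥-elim (0≉1 (sym 1≈0))
    toF-injective {true}  {true}  _ = ≡.refl

    fromF : F → Bool
    fromF x = isYes (x ≟ 1#)

    toF-fromF : ∀ x → toF (fromF x) ≈ x
    toF-fromF x with x ≟ 1# | size≡2⇒0-or-1 size≡2 x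
    ... | yes x≈1 | _        = sym x≈1
    ... | no  _   | inj₁ x≈0 = sym x≈0
    ... | no  x≉1 | inj₂ x≈1 = ⊥-elim (x≉1 x≈1)

    toM : 𝔹.Mat₂ → MatF
    toM = map toF

    toM-* : ∀ X Y → toM (X 𝔹.*₂ Y) ≈F (toM X *F toM Y)
    toM-* = map-*₂ xor-∧-commutativeRing commRing toF toF-xor toF-∧

    toM-det : ∀ X → toF (𝔹.det₂ X) ≈ detF (toM X)
    toM-det = map-det₂ xor-∧-commutativeRing commRing toF toF-xor toF-∧ toF-self-inverse

    toM-injective : ∀ {X Y} → toM X ≈F toM Y → X ≡ Y
    toM-injective {mat a b c d} {mat a′ b′ c′ d′} (p , q , r , s)
      with toF-injective {a} {a′} p | toF-injective {b} {b′} q | toF-injective {c} {c′} r | toF-injective {d} {d′} s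
    ... | ≡.refl | ≡.refl | ≡.refl | ≡.refl = ≡.refl

    toM-≡ : ∀ {X Y} → X ≡ Y → toM X ≈F toM Y
    toM-≡ ≡.refl = MF.≈₂-refl

    -- The involutions of SL₂(𝔽₂) are upper 1, lower 1 and antidiag, all conjugate to upper 1.
    involution-conjugate : ∀ X → 𝔹.det₂ X ≡ true → X 𝔹.*₂ X ≡ 𝔹.1₂ → X ≢ 𝔹.1₂ →
      Σ 𝔹.Mat₂ λ h → Σ 𝔹.Mat₂ λ H → h 𝔹.*₂ H ≡ 𝔹.1₂ × h 𝔹.*₂ X 𝔹.*₂ H ≡ 𝔹.upper true
    involution-conjugate (mat false false false false) ()
    involution-conjugate (mat false false false true ) ()
    involution-conjugate (mat false false true  false) ()
    involution-conjugate (mat false false true  true ) ()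
    involution-conjugate (mat false true  false false) ()
    involution-conjugate (mat false true  false true ) ()
    involution-conjugate (mat false true  true  false) _ _ _ = 𝔹.lower true , 𝔹.lower true , ≡.refl , ≡.refl
    involution-conjugate (mat false true  true  true ) _ ()
    involution-conjugate (mat true  false false false) ()
    involution-conjugate (mat true  false false true ) _ _ X≢1 = ⊥-elim (X≢1 ≡.refl)
    involution-conjugate (mat true  false true  false) ()
    involution-conjugate (mat true  false true  true ) _ _ _ = 𝔹.antidiag , 𝔹.antidiag , ≡.refl , ≡.refl
    involution-conjugate (mat true  true  false false) ()
    involution-conjugate (mat true  true  false true ) _ _ _ = 𝔹.1₂ , 𝔹.1₂ , ≡.refl , ≡.refl
    involution-conjugate (mat true  true  true  false) _ ()
    involution-conjugate (mat true  true  true  true ) ()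

    upper-one-lifts : Σ Mat (λ S → G S × InSL₂ S × ¬ (reduce S ≈F IF) × ((reduce S *F reduce S) ≈F IF)) →
                      LiftsToSL (MF.upper 1#)
    upper-one-lifts (S , S∈G , detS≈1 , S≢1 , S²≈1) = conjugate-by (involution-conjugate X detX≡true X²≡1 X≢1)
      where
      X : 𝔹.Mat₂
      X = map fromF (reduce S)
      S≈X : reduce S ≈F toM X
      S≈X = MF.≈₂-sym (toF-fromF _ , toF-fromF _ , toF-fromF _ , toF-fromF _)
      detX≡true : 𝔹.det₂ X ≡ true
      detX≡true = toF-injective {𝔹.det₂ X} {true}
        (trans (toM-det X) (trans (MF.det₂-cong (MF.≈₂-sym S≈X)) (trans (sym (det-reduce S)) (detS≈1 0))))
      X²≡1 : X 𝔹.*₂ X ≡ 𝔹.1₂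
      X²≡1 = toM-injective {X 𝔹.*₂ X} {𝔹.1₂}
        (MF.≈₂-trans (toM-* X X) (MF.≈₂-trans (MF.*₂-cong (MF.≈₂-sym S≈X) (MF.≈₂-sym S≈X)) S²≈1))
      X≢1 : X ≢ 𝔹.1₂
      X≢1 X≡1 = S≢1 (MF.≈₂-trans S≈X (toM-≡ X≡1))
      conjugate-by : Σ 𝔹.Mat₂ (λ h → Σ 𝔹.Mat₂ λ H → h 𝔹.*₂ H ≡ 𝔹.1₂ × h 𝔹.*₂ X 𝔹.*₂ H ≡ 𝔹.upper true) →
                     LiftsToSL (MF.upper 1#)
      conjugate-by (h , H , hH≡1 , hXH≡upper) = LiftsToSL-resp hXH≈upper
        (conjugate-lifts (MF.≈₂-trans (MF.≈₂-sym (toM-* h H)) (toM-≡ hH≡1)) (S , S∈G , detS≈1 , S≈X))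
        where
        hXH≈upper : (toM h *F toM X *F toM H) ≈F MF.upper 1#
        hXH≈upper = MF.≈₂-trans (MF.*₂-cong (MF.≈₂-sym (toM-* h X)) MF.≈₂-refl)
          (MF.≈₂-trans (MF.≈₂-sym (toM-* (h 𝔹.*₂ X) H)) (toM-≡ hXH≡upper))

  upper-lifts : CondE G → ∀ x → LiftsToSL (MF.upper x)
  upper-lifts condE x with size≡2⇒0-or-1 size≡2 x
  ... | inj₁ x≈0 = IM , has-I , M.det₂-1 , (refl , sym x≈0 , refl , refl)
  ... | inj₂ x≈1 = LiftsToSL-resp (refl , sym x≈1 , refl , refl) (upper-one-lifts (condE size≡2))

  -- By (d), some B ∈ G is ≡ diag(1 + π, 1) modulo π², so B ≡ 1 + πE₁₁; conjugate by upper x.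
  E₁₂-lifts₁ : CondD G → ∀ x → LiftsAtLevel 1 (MF.E₁₂ x)
  E₁₂-lifts₁ condD x = conjugate-E₁₁ (condD size≡2 diag[1+π,1] (u , λ n _ → [1+π]u≈1 n))
    where
    u = proj₁ diag[1+π,1]∈GL₂
    [1+π]u≈1 = proj₂ diag[1+π,1]∈GL₂
    open MF using (prove₂; :upper; :E₁₁; :E₁₂; _:*₂_; _:-₂_; :1₂)
    open IntegerCoefficientSolver commRing using (var; :-_)
    conjugate-E₁₁ : Σ Mat (λ B → G B × B ≡M diag[1+π,1] [mod𝔭^ 2 ]) → LiftsAtLevel 1 (MF.E₁₂ x)
    conjugate-E₁₁ (B , B∈G , B≡) = LiftsAtLevel-resp conjugate≈
      (conjugation-difference 0 upper-inverse B∈G (≡1+π^-rebase 1 (≡mod⇒-∈M𝔭^ B≡) diag[1+π,1]≡))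
      where
      𝐱 = var (# 0)
      upper-inverse : (MF.upper (- x) *F MF.upper x) ≈F IF
      upper-inverse = prove₂ (x ∷ []) (:upper (:- 𝐱) :*₂ :upper 𝐱) :1₂ (refl , refl , refl , refl)
      conjugate≈ : (MF.upper x *F ((MF.upper (- x) -F IF) *F MF.E₁₁ -F MF.E₁₁ *F (MF.upper (- x) -F IF))) ≈F MF.E₁₂ x
      conjugate≈ = prove₂ (x ∷ [])
        (:upper 𝐱 :*₂ ((:upper (:- 𝐱) :-₂ :1₂) :*₂ :E₁₁ :-₂ :E₁₁ :*₂ (:upper (:- 𝐱) :-₂ :1₂))) (:E₁₂ 𝐱)
        (refl , refl , refl , refl)

module _ {c ℓ p} (𝔽 : FiniteField c ℓ) (G : PowerSeries.Mat 𝔽 → Set p)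
    (SG : PowerSeries.IsSubgroupGL₂ 𝔽 G) (condB : PowerSeries.CondB 𝔽 G) where
  open PowerSeries 𝔽
  open MatrixValuation 𝔽 using (module MF)
  open Levels 𝔽 G SG using (LiftsAtLevel)
  open ResidueLifts 𝔽 G SG condB using (LiftsToSL)

  elementary-lifts : CondC G → CondD G → CondE G →
    (∀ x → LiftsAtLevel 1 (MF.E₁₂ x)) × (∀ x → LiftsToSL (MF.upper x))
  elementary-lifts condC condD condE with FiniteFieldFacts.size-cases 𝔽
  ... | inj₁ 2<size = E₁₂-lifts₁ condC , upper-lifts
    where open LargeResidueField 𝔽 G SG condB 2<size
  ... | inj₂ size≡2 = E₁₂-lifts₁ condD , upper-lifts condE
    where open TwoElementResidueField 𝔽 G SG condB size≡2

proposition2p1 : ∀ {c ℓ p : Level} (𝔽 : FiniteField c ℓ) → let open PowerSeries 𝔽 in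
    (G : Mat → Set p) → IsSubgroupGL₂ G → IsClosed G →
    CondA G → CondB G → CondC G → CondD G → CondE G →
    ∀ A → InGL₂ A → G A
proposition2p1 𝔽 G SG closed condA condB condC condD condE =
  let E₁₂-lifts , upper-lifts = elementary-lifts 𝔽 G SG condB condC condD condE
  in everything-in-G E₁₂-lifts (approximates₁ condA (SL₂F-lifts upper-lifts))
  where
  open ResidueLifts 𝔽 G SG condB using (approximates₁; SL₂F-lifts)
  open FromLevelOne 𝔽 G SG closed condB using (everything-in-G)
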